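{- Let $P=([n],\prec)$ be any finite interval order and let $M_P$ be the matrix defined below. Then for every integral vector $\boldsymbol b$, the linear system $M_P\boldsymbol x\le\boldsymbol b$ (in the variables $\boldsymbol x=(\ell_1,\dots,\ell_n,\rho_1,\dots,\rho_n)$) is totally dual integral.
   Context: A finite partial order $P=([n],\prec)$ is an interval order if there are compact real intervals $I_x=[\ell_x,r_x]$, $x\in[n]$, such that $x\prec y$ iff $r_x<\ell_y$. Write $x\parallel y$ if $x\neq y$ and $x,y$ are incomparable. The canonical representation $[\ell_x,r_x]_{x\in[n]}$ of $P$ is the (unique) interval representation of $P$ using the minimum possible number $m$ of distinct endpoints, placed at the integers $0,\dots,m-1$. For $y\not\prec x$, the slack of $(x,y)$ in the canonical representation is $\ell_y-r_x-1$ if $x\prec y$, $r_y-\ell_x$ if $x\parallel y$, $r_x-\ell_x$ if $x=y$; a pair with slack $0$ is a slack zero pair, called a slack zero cover pair if $x\prec y$ and a slack zero sharp pair if $x\parallel y$. $M_P$ is the $\{0,\pm1\}$-matrix with columns indexed by $\ell_1,\dots,\ell_n,\rho_1,\dots,\rho_n$ whose rows are the coefficient vectors of: $\ell_x+\rho_x-\ell_y$ for each slack zero cover pair $(x,y)$; $\ell_x-\ell_y-\rho_y$ for each slack zero sharp pair $(x,y)$; $-\rho_x$ for each slack zero pair $(x,x)$; $-\ell_x$ for every $x\in[n]$. A system $A\boldsymbol x\le\boldsymbol b$ is totally dual integral (TDI) if for every integral vector $\boldsymbol c$ for which $\max\{\boldsymbol c^T\boldsymbol x: A\boldsymbol x\le\boldsymbol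 b\}$ is finite, the dual problem $\min\{\boldsymbol b^T\boldsymbol y: A^T\boldsymbol y=\boldsymbol c,\ \boldsymbol y\ge 0\}$ has an integral optimal solution.
   Formalization: The interval endpoints are rational rather than real, including in the minimality condition of the canonical representation, and the primal and dual variables in the definition of total dual integrality range over ℚ. -}

module Defs where

open import Data.Nat as ℕ using (ℕ; zero; suc)
open import Data.Nat.Properties as ℕP using ()
open import Data.Integer as ℤ using (ℤ; +_; -_)
open import Data.Rational as ℚ using (ℚ; 0ℚ; _/_)
open import Data.Rational.Properties as ℚP using ()
open import Data.Fin as Fin using (Fin; splitAt)
open import Data.Fin.Properties as FinP using ()
open import Data.List as List using (List; []; _∷_; _++_; length; concatMap; allFin; deduplicate; map; lookup)
open import Data.Sum using (_⊎_; inj₁; inj₂)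
open import Data.Product using (_×_; _,_; ∃; ∃-syntax; Σ-syntax)
open import Data.Bool using (Bool; true; false; if_then_else_; _∧_; not)
open import Relation.Nullary using (¬_; ⌊_⌋)
open import Relation.Binary.PropositionalEquality using (_≡_; _≢_)
open import Function.Bundles using (_⇔_)

-- Generic linear algebra over ℚ (the LP data are integral, hence rational;
-- for rational data, LP feasibility/boundedness/optimality over ℚ coincide
-- with those over ℝ).

ι : ℤ → ℚ
ι z = z / 1

Σℚ : ∀ {d} → (Fin d → ℚ) → ℚ
Σℚ {zero}  f = 0ℚ
Σℚ {suc d} f = f Fin.zero ℚ.+ Σℚ (λ i → f (Fin.suc i))

Matrix : ℕ → ℕ → Set
Matrix k d = Fin k → Fin d → ℤ

rowDot : ∀ {k d} → Matrix k d → Fin k → (Fin d → ℚ) → ℚ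
rowDot A i x = Σℚ (λ j → ι (A i j) ℚ.* x j)

dotℚ : ∀ {d} → (Fin d → ℤ) → (Fin d → ℚ) → ℚ
dotℚ c x = Σℚ (λ j → ι (c j) ℚ.* x j)

PrimalFeasible : ∀ {k d} → Matrix k d → (Fin k → ℤ) → (Fin d → ℚ) → Set
PrimalFeasible A b x = ∀ i → rowDot A i x ℚ.≤ ι (b i)

PrimalMaxFinite : ∀ {k d} → Matrix k d → (Fin k → ℤ) → (Fin d → ℤ) → Set
PrimalMaxFinite A b c =
  (∃[ x ] PrimalFeasible A b x) ×
  (∃[ B ] (∀ x → PrimalFeasible A b x → dotℚ c x ℚ.≤ B))

DualFeasible : ∀ {k d} → Matrix k d → (Fin d → ℤ) → (Fin k → ℚ) → Set
DualFeasible A c y =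
  (∀ i → 0ℚ ℚ.≤ y i) × (∀ j → Σℚ (λ i → y i ℚ.* ι (A i j)) ≡ ι (c j))

DualOptimal : ∀ {k d} → Matrix k d → (Fin k → ℤ) → (Fin d → ℤ) → (Fin k → ℚ) → Set
DualOptimal A b c y =
  DualFeasible A c y × (∀ y' → DualFeasible A c y' → dotℚ b y ℚ.≤ dotℚ b y')

TDI : ∀ {k d} → Matrix k d → (Fin k → ℤ) → Set
TDI {k} {d} A b = ∀ (c : Fin d → ℤ) → PrimalMaxFinite A b c →
  Σ[ y ∈ (Fin k → ℤ) ] DualOptimal A b c (λ i → ι (y i))

IsIntervalRep : ∀ {n} → (Fin n → Fin n → Set) → (Fin n → ℚ) → (Fin n → ℚ) → Set
IsIntervalRep {n} _≺_ ℓ r =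
  (∀ x → ℓ x ℚ.≤ r x) × (∀ x y → (x ≺ y) ⇔ (r x ℚ.< ℓ y))

IsIntervalOrder : ∀ {n} → (Fin n → Fin n → Set) → Set
IsIntervalOrder _≺_ = ∃[ ℓ ] ∃[ r ] IsIntervalRep _≺_ ℓ r

endpoints : ∀ {n} {A : Set} → (Fin n → A) → (Fin n → A) → List A
endpoints ℓ r = map ℓ (allFin _) ++ map r (allFin _)

#distinct : ∀ {n} → (Fin n → ℚ) → (Fin n → ℚ) → ℕ
#distinct ℓ r = length (deduplicate ℚP._≟_ (endpoints ℓ r))

IsCanonicalRep : ∀ {n} → (Fin n → Fin n → Set) → (Fin n → ℕ) → (Fin n → ℕ) → ℕ → Set
IsCanonicalRep {n} _≺_ ℓ r m =
  IsIntervalRep _≺_ (λ x → ι (+ ℓ x)) (λ x → ι (+ r x)) ×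
  (∀ x → ℓ x ℕ.< m) × (∀ x → r x ℕ.< m) ×
  (∀ v → v ℕ.< m → ∃[ x ] (ℓ x ≡ v ⊎ r x ≡ v)) ×
  (∀ ℓ' r' → IsIntervalRep _≺_ ℓ' r' → m ℕ.≤ #distinct ℓ' r')

-- The matrix M_P.  Columns: Fin (n + n), the first n are ℓ_1..ℓ_n,
-- the last n are ρ_1..ρ_n.

Row : ℕ → Set
Row n = Fin (n ℕ.+ n) → ℤ

eℓ : ∀ {n} → Fin n → Row n
eℓ {n} x j with splitAt n j
... | inj₁ i = if ⌊ i Fin.≟ x ⌋ then + 1 else + 0
... | inj₂ i = + 0

eρ : ∀ {n} → Fin n → Row n
eρ {n} x j with splitAt n j
... | inj₁ i = + 0
... | inj₂ i = if ⌊ i Fin.≟ x ⌋ then + 1 else + 0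

_⊕_ _⊖_ : ∀ {n} → Row n → Row n → Row n
(u ⊕ v) j = u j ℤ.+ v j
(u ⊖ v) j = u j ℤ.- v j

neg : ∀ {n} → Row n → Row n
neg u j = - u j

module _ {n : ℕ} (ℓ r : Fin n → ℕ) where
  precᵇ : Fin n → Fin n → Bool
  precᵇ x y = ⌊ r x ℕ.<? ℓ y ⌋

  incompᵇ : Fin n → Fin n → Bool
  incompᵇ x y = not ⌊ x Fin.≟ y ⌋ ∧ not (precᵇ x y) ∧ not (precᵇ y x)

  coverZeroᵇ : Fin n → Fin n → Bool
  coverZeroᵇ x y = precᵇ x y ∧ ⌊ ℓ y ℕ.≟ suc (r x) ⌋

  sharpZeroᵇ : Fin n → Fin n → Bool
  sharpZeroᵇ x y = incompᵇ x y ∧ ⌊ r y ℕ.≟ ℓ x ⌋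

  selfZeroᵇ : Fin n → Bool
  selfZeroᵇ x = ⌊ r x ℕ.≟ ℓ x ⌋

  pairRows : Fin n → Fin n → List (Row n)
  pairRows x y =
    (if coverZeroᵇ x y then (_⊖_ {n} (_⊕_ {n} (eℓ x) (eρ x)) (eℓ y)) ∷ [] else []) ++
    (if sharpZeroᵇ x y then (_⊖_ {n} (_⊖_ {n} (eℓ x) (eℓ y)) (eρ y)) ∷ [] else [])

  singleRows : Fin n → List (Row n)
  singleRows x =
    (if selfZeroᵇ x then neg {n} (eρ x) ∷ [] else []) ++ (neg {n} (eℓ x) ∷ [])

  MP-rows : List (Row n)
  MP-rows = concatMap (λ x → concatMap (pairRows x) (allFin n)) (allFin n)
            ++ concatMap singleRows (allFin n)

  MP : Matrix (length MP-rows) (n ℕ.+ n)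
  MP i = lookup MP-rows i

-- After the unimodular substitution r_x = ℓ_x + ρ_x every row of M_P is a difference of two
-- variables (r_x − ℓ_y, ℓ_x − r_y, ℓ_x − r_x) or −ℓ_x.  So M_P x ≤ b is a system of difference
-- constraints p(t) − p(h) ≤ b_e on a digraph with a root of potential 0, and its dual is a
-- min-cost flow problem.  An integral optimal dual comes from the primal–dual method: keep an
-- integral feasible potential p and an integral flow y that uses only tight arcs; while a node v
-- has positive excess (negative excess is symmetric), either send one unit from v to a sink (the
-- root or a node of negative excess) forwards along tight arcs and backwards along used arcs, or,
-- if no sink is reachable, raise p by one on all nodes that cannot reach a sink, which keeps p
-- feasible and strictly increases c·p.  As c·p is bounded by the finite primal optimum, the method
-- stops with a conserving flow complementary to p, and weak duality makes it optimal.
module Submission where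

open import Defs

open import Algebra.Bundles using (CommutativeRing; Monoid)
open import Data.Bool using (Bool; true; false; if_then_else_)
open import Data.Bool.Properties using (T-≡)
open import Data.Empty using (⊥-elim)
open import Data.Fin as Fin using (Fin; _↑ˡ_; _↑ʳ_; splitAt)
import Data.Fin.Properties as FinP
open import Data.Fin.Subset using (Subset; _∈_; _∉_; _∪_; ⁅_⁆; _⊆_; _⊂_; _⊃_)
open import Data.Fin.Subset.Induction using (⊃-wellFounded)
open import Data.Fin.Subset.Properties using (_∈?_; p⊆p∪q; x∈p∪q⁺; x∈p∪q⁻; x∈⁅x⁆; x∈⁅y⁆⇒x≡y)
open import Data.Integer as ℤ using (ℤ; +_; +[1+_]; -[1+_]; 0ℤ; 1ℤ)
import Data.Integer.DivMod as ℤDM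
import Data.Integer.Properties as ℤP
open import Data.Integer.Tactic.RingSolver using (solve-∀)
open import Data.List as List using (List; []; _∷_; allFin; length)
open import Data.List.Membership.Propositional.Properties using (∈-lookup)
open import Data.List.Relation.Unary.All as All using (All; []; _∷_)
open import Data.List.Relation.Unary.All.Properties using (++⁺; concat⁺; map⁺)
open import Data.Maybe using (Maybe; just; nothing)
open import Data.Nat as ℕ using (ℕ; zero; suc)
import Data.Nat.Coprimality as Cop
open import Data.Nat.Induction using (<-wellFounded)
import Data.Nat.Properties as ℕP
open import Data.Product using (Σ; _×_; _,_; proj₁; proj₂; Σ-syntax)
open import Data.Product.Relation.Binary.Lex.Strict using (×-Lex; ×-wellFounded)
open import Data.Rational as ℚ using (ℚ; 0ℚ; mkℚ; _/_)
import Data.Rational.Properties as ℚP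
open import Data.Sum as Sum using (_⊎_; inj₁; inj₂)
open import Data.Unit using (⊤; tt)
open import Data.Vec using (tabulate)
open import Data.Vec.Properties using (lookup∘tabulate; []=⇒lookup; lookup⇒[]=)
import Data.Vec.Functional as VecF
open import Data.Vec.Functional using (updateAt)
open import Data.Vec.Functional.Properties using (updateAt-updates; updateAt-minimal; lookup-++ˡ; lookup-++ʳ)
open import Function using (_∘_)
open import Function.Bundles using (Equivalence)
open import Induction.WellFounded using (Acc; acc)
open import Relation.Binary.Definitions using (tri<; tri≈; tri>)
open import Relation.Binary.PropositionalEquality
  using (_≡_; _≢_; refl; sym; trans; cong; cong₂; subst; subst₂; module ≡-Reasoning)
open import Relation.Nullary using (¬_; Dec; yes; no; does; ¬?; isYes; ⌊_⌋)
open import Relation.Nullary.Decidable using (dec-false; _×-dec_; _⊎-dec_; toWitness; fromWitness)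

open import Algebra.Properties.Ring ℤP.+-*-ring using () renaming ([y-z]x≈yx-zx to ℤ[y-z]x≈yx-zx)
open import Algebra.Properties.Ring ℚP.+-*-ring using () renaming ([y-z]x≈yx-zx to ℚ[y-z]x≈yx-zx)

module RingSum {c ℓ} (R : CommutativeRing c ℓ) where
  open CommutativeRing R hiding (refl) renaming (sym to ≈-sym; trans to ≈-trans)
  open import Algebra.Properties.Semiring.Sum semiring public
  open import Algebra.Properties.Ring ring using (-1*x≈-x)
  open import Relation.Binary.Reasoning.Setoid setoid

  sum-neg : ∀ {n} (f : Fin n → Carrier) → sum (λ i → - f i) ≈ - sum f
  sum-neg f = begin
    sum (λ i → - f i)       ≈⟨ sum-cong-≋ (λ i → ≈-sym (-1*x≈-x (f i))) ⟩
    sum (λ i → - 1# * f i)  ≈⟨ ≈-sym (*-distribˡ-sum (- 1#) f) ⟩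
    - 1# * sum f            ≈⟨ -1*x≈-x (sum f) ⟩
    - sum f                 ∎

  sum-sub : ∀ {n} (f g : Fin n → Carrier) → sum (λ i → f i - g i) ≈ sum f - sum g
  sum-sub f g = ≈-trans (∑-distrib-+ f (λ i → - g i)) (+-congˡ (sum-neg g))

  sum-zero : ∀ {n} {f : Fin n → Carrier} → (∀ i → f i ≈ 0#) → sum f ≈ 0#
  sum-zero {n} f≈0 = ≈-trans (sum-cong-≋ f≈0) (sum-replicate-zero n)

  sum-δ : ∀ {n} (f : Fin n → Carrier) (a : Fin n) → (∀ i → i ≢ a → f i ≈ 0#) → sum f ≈ f a
  sum-δ f Fin.zero f≈0 = ≈-trans (+-congˡ (sum-zero (λ i → f≈0 (Fin.suc i) λ ()))) (+-identityʳ _)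
  sum-δ f (Fin.suc a) f≈0 = ≈-trans (+-cong (f≈0 Fin.zero λ ()) (sum-δ (f ∘ Fin.suc) a f∘suc≈0)) (+-identityˡ _)
    where
    f∘suc≈0 : ∀ i → i ≢ a → f (Fin.suc i) ≈ 0#
    f∘suc≈0 i i≢a = f≈0 (Fin.suc i) (i≢a ∘ FinP.suc-injective)

  sum-↑ : ∀ m {n} (f : Fin (m ℕ.+ n) → Carrier) → sum f ≈ sum (λ i → f (i ↑ˡ n)) + sum (λ i → f (m ↑ʳ i))
  sum-↑ zero f = ≈-sym (+-identityˡ _)
  sum-↑ (suc m) f = ≈-trans (+-congˡ (sum-↑ m (f ∘ Fin.suc))) (≈-sym (+-assoc _ _ _))

module SumMonotone {c ℓ r} (M : Monoid c ℓ) (_≤_ : Monoid.Carrier M → Monoid.Carrier M → Set r)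
  (≤-refl : ∀ {x} → x ≤ x)
  (+-mono-≤ : ∀ {x y u v} → x ≤ y → u ≤ v → Monoid._∙_ M x u ≤ Monoid._∙_ M y v) where
  open Monoid M using (Carrier)
  open import Algebra.Properties.Monoid.Sum M using (sum)

  sum-mono-≤ : ∀ {n} {f g : Fin n → Carrier} → (∀ i → f i ≤ g i) → sum f ≤ sum g
  sum-mono-≤ {zero} f≤g = ≤-refl
  sum-mono-≤ {suc n} f≤g = +-mono-≤ (f≤g Fin.zero) (sum-mono-≤ (f≤g ∘ Fin.suc))

module ℤΣ where
  open RingSum ℤP.+-*-commutativeRing public

  0≤sum : ∀ {n} {f : Fin n → ℤ} → (∀ i → 0ℤ ℤ.≤ f i) → 0ℤ ℤ.≤ sum f
  0≤sum {zero} f≥0 = ℤP.≤-refl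
  0≤sum {suc n} f≥0 = ℤP.+-mono-≤ (f≥0 Fin.zero) (0≤sum (f≥0 ∘ Fin.suc))

  ≤-sum : ∀ {n} {f : Fin n → ℤ} (a : Fin n) → (∀ i → 0ℤ ℤ.≤ f i) → f a ℤ.≤ sum f
  ≤-sum {f = f} Fin.zero f≥0 = ℤP.i≤i+j (f Fin.zero) _ {{ℤ.nonNegative (0≤sum (f≥0 ∘ Fin.suc))}}
  ≤-sum (Fin.suc a) f≥0 = ℤP.i≤j⇒i≤k+j _ {{ℤ.nonNegative (f≥0 Fin.zero)}} (≤-sum a (f≥0 ∘ Fin.suc))

module ℚΣ where
  open RingSum ℚP.+-*-commutativeRing public
  open SumMonotone ℚP.+-0-monoid ℚ._≤_ ℚP.≤-refl ℚP.+-mono-≤ public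

module ℕΣ where
  open import Algebra.Properties.Monoid.Sum ℕP.+-0-monoid public using (sum; sum-cong-≗)
  open SumMonotone ℕP.+-0-monoid ℕ._≤_ ℕP.≤-refl ℕP.+-mono-≤ public

  sum-mono-< : ∀ {n} {f g : Fin n → ℕ} → (∀ i → f i ℕ.≤ g i) → (a : Fin n) → f a ℕ.< g a → sum f ℕ.< sum g
  sum-mono-< f≤g Fin.zero fa<ga = ℕP.+-mono-<-≤ fa<ga (sum-mono-≤ (f≤g ∘ Fin.suc))
  sum-mono-< f≤g (Fin.suc a) fa<ga = ℕP.+-mono-≤-< (f≤g Fin.zero) (sum-mono-< (f≤g ∘ Fin.suc) a fa<ga)

Σℚ≡sum : ∀ {n} (f : Fin n → ℚ) → Σℚ f ≡ ℚΣ.sum f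
Σℚ≡sum {zero} f = refl
Σℚ≡sum {suc n} f = cong (f Fin.zero ℚ.+_) (Σℚ≡sum (f ∘ Fin.suc))

coprime-1 : ∀ z → Cop.Coprime ℤ.∣ z ∣ 1
coprime-1 z = Cop.sym (Cop.1-coprimeTo ℤ.∣ z ∣)

ι≡mkℚ : ∀ z → ι z ≡ mkℚ z 0 (coprime-1 z)
ι≡mkℚ z = ℚP.↥p/↧p≡p (mkℚ z 0 (coprime-1 z))

ι-+ : ∀ a b → ι (a ℤ.+ b) ≡ ι a ℚ.+ ι b
ι-+ a b rewrite ι≡mkℚ a | ι≡mkℚ b =
  sym (cong₂ (λ u v → (u ℤ.+ v) / 1) (ℤP.*-identityʳ a) (ℤP.*-identityʳ b))

ι-* : ∀ a b → ι (a ℤ.* b) ≡ ι a ℚ.* ι b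
ι-* a b rewrite ι≡mkℚ a | ι≡mkℚ b = refl

ι-neg : ∀ a → ι (ℤ.- a) ≡ ℚ.- ι a
ι-neg a rewrite ι≡mkℚ a | ι≡mkℚ (ℤ.- a) = mkℚ-neg a
  where
  mkℚ-neg : ∀ a → mkℚ (ℤ.- a) 0 (coprime-1 (ℤ.- a)) ≡ ℚ.- mkℚ a 0 (coprime-1 a)
  mkℚ-neg (+ zero) = refl
  mkℚ-neg +[1+ n ] = refl
  mkℚ-neg -[1+ n ] = refl

ι-- : ∀ a b → ι (a ℤ.- b) ≡ ι a ℚ.- ι b
ι-- a b = trans (ι-+ a (ℤ.- b)) (cong (ι a ℚ.+_) (ι-neg b))

ι-sum : ∀ {n} (f : Fin n → ℤ) → ι (ℤΣ.sum f) ≡ ℚΣ.sum (ι ∘ f)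
ι-sum {zero} f = refl
ι-sum {suc n} f = trans (ι-+ (f Fin.zero) _) (cong (ι (f Fin.zero) ℚ.+_) (ι-sum (f ∘ Fin.suc)))

sum-ι* : ∀ {n} (f g : Fin n → ℤ) → ℚΣ.sum (λ i → ι (f i) ℚ.* ι (g i)) ≡ ι (ℤΣ.sum (λ i → f i ℤ.* g i))
sum-ι* f g = trans (ℚΣ.sum-cong-≗ (λ i → sym (ι-* (f i) (g i)))) (sym (ι-sum (λ i → f i ℤ.* g i)))

Σℚ-ι* : ∀ {n} (f g : Fin n → ℤ) → Σℚ (λ i → ι (f i) ℚ.* ι (g i)) ≡ ι (ℤΣ.sum (λ i → f i ℤ.* g i))
Σℚ-ι* f g = trans (Σℚ≡sum (λ i → ι (f i) ℚ.* ι (g i))) (sum-ι* f g)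

ι-mono-≤ : ∀ {a b} → a ℤ.≤ b → ι a ℚ.≤ ι b
ι-mono-≤ {a} {b} a≤b rewrite ι≡mkℚ a | ι≡mkℚ b =
  ℚ.*≤* (subst₂ ℤ._≤_ (sym (ℤP.*-identityʳ a)) (sym (ℤP.*-identityʳ b)) a≤b)

ι-cancel-< : ∀ {a b} → ι a ℚ.< ι b → a ℤ.< b
ι-cancel-< {a} {b} ιa<ιb rewrite ι≡mkℚ a | ι≡mkℚ b with ιa<ιb
... | ℚ.*<* a*1<b*1 = subst₂ ℤ._<_ (ℤP.*-identityʳ a) (ℤP.*-identityʳ b) a*1<b*1

floor-≤ : ∀ p → ι (ℚ.floor p) ℚ.≤ p
floor-≤ p@(mkℚ a d-1 _) rewrite ι≡mkℚ (ℚ.floor p) =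
  ℚ.*≤* (ℤP.≤-trans (ℤDM.[n/d]*d≤n a (+ suc d-1)) (ℤP.≤-reflexive (sym (ℤP.*-identityʳ a))))

<-suc-floor : ∀ p → p ℚ.< ι (ℤ.suc (ℚ.floor p))
<-suc-floor p@(mkℚ a d-1 _) rewrite ι≡mkℚ (ℤ.suc (ℚ.floor p)) = ℚ.*<* (begin-strict
    a ℤ.* 1ℤ                   ≡⟨ ℤP.*-identityʳ a ⟩
    a                          ≡⟨ ℤDM.a≡a%n+[a/n]*n a d ⟩
    + (a ℤ.% d) ℤ.+ q ℤ.* d    <⟨ ℤP.+-monoˡ-< (q ℤ.* d) (ℤ.+<+ (ℤDM.n%d<d a d)) ⟩
    d ℤ.+ q ℤ.* d              ≡⟨ sym (ℤP.suc-* q d) ⟩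
    ℤ.suc q ℤ.* d              ∎)
  where
  open ℤP.≤-Reasoning
  d q : ℤ
  d = + suc d-1
  q = a ℤ./ d

floor-sub-≤ : ∀ p q z → p ℚ.- q ℚ.≤ ι z → ℚ.floor p ℤ.- ℚ.floor q ℤ.≤ z
floor-sub-≤ p q z p-q≤z =
  ℤP.≤-trans (ℤP.+-monoˡ-≤ (ℤ.- ℚ.floor q) ⌊p⌋≤z+⌊q⌋) (ℤP.≤-reflexive (shift z (ℚ.floor q)))
  where
  shift : ∀ z u → z ℤ.+ u ℤ.- u ≡ z
  shift = solve-∀
  +-suc : ∀ z u → z ℤ.+ (1ℤ ℤ.+ u) ≡ 1ℤ ℤ.+ (z ℤ.+ u)
  +-suc = solve-∀
  p-q+q≡p : ∀ p q → p ℚ.- q ℚ.+ q ≡ p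
  p-q+q≡p p q = trans (ℚP.+-assoc p (ℚ.- q) q) (trans (cong (p ℚ.+_) (ℚP.+-inverseˡ q)) (ℚP.+-identityʳ p))
  open ℚP.≤-Reasoning
  ⌊p⌋<1+z+⌊q⌋ : ι (ℚ.floor p) ℚ.< ι (ℤ.suc (z ℤ.+ ℚ.floor q))
  ⌊p⌋<1+z+⌊q⌋ = begin-strict
    ι (ℚ.floor p)                 ≤⟨ floor-≤ p ⟩
    p                             ≡⟨ sym (p-q+q≡p p q) ⟩
    p ℚ.- q ℚ.+ q                 ≤⟨ ℚP.+-monoˡ-≤ q p-q≤z ⟩
    ι z ℚ.+ q                     <⟨ ℚP.+-monoʳ-< (ι z) (<-suc-floor q) ⟩
    ι z ℚ.+ ι (ℤ.suc (ℚ.floor q)) ≡⟨ sym (ι-+ z _) ⟩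
    ι (z ℤ.+ ℤ.suc (ℚ.floor q))   ≡⟨ cong ι (+-suc z (ℚ.floor q)) ⟩
    ι (ℤ.suc (z ℤ.+ ℚ.floor q))   ∎
  ⌊p⌋≤z+⌊q⌋ : ℚ.floor p ℤ.≤ z ℤ.+ ℚ.floor q
  ⌊p⌋≤z+⌊q⌋ = subst (ℚ.floor p ℤ.≤_) (ℤP.pred-suc (z ℤ.+ ℚ.floor q))
                     (ℤP.i<j⇒i≤pred[j] (ι-cancel-< {b = ℤ.suc (z ℤ.+ ℚ.floor q)} ⌊p⌋<1+z+⌊q⌋))

weak-duality : ∀ {k d} (A : Matrix k d) (b : Fin k → ℤ) (c : Fin d → ℤ) {x y} →
  PrimalFeasible A b x → DualFeasible A c y → dotℚ c x ℚ.≤ dotℚ b y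
weak-duality {k} {d} A b c {x} {y} Ax≤b (y≥0 , Aᵀy≡c) = begin
  dotℚ c x
    ≡⟨ Σℚ≡sum (λ j → ι (c j) ℚ.* x j) ⟩
  sum (λ j → ι (c j) ℚ.* x j)
    ≡⟨ sum-cong-≗ (λ j → cong (ℚ._* x j) (Aᵀy j)) ⟨
  sum (λ j → sum (λ i → y i ℚ.* ι (A i j)) ℚ.* x j)
    ≡⟨ sum-cong-≗ (λ j → *-distribʳ-sum (x j) (λ i → y i ℚ.* ι (A i j))) ⟩
  sum (λ j → sum (λ i → y i ℚ.* ι (A i j) ℚ.* x j))
    ≡⟨ ∑-comm (λ j i → y i ℚ.* ι (A i j) ℚ.* x j) ⟩
  sum (λ i → sum (λ j → y i ℚ.* ι (A i j) ℚ.* x j))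
    ≡⟨ sum-cong-≗ (λ i → sum-cong-≗ (λ j → ℚP.*-assoc (y i) (ι (A i j)) (x j))) ⟩
  sum (λ i → sum (λ j → y i ℚ.* (ι (A i j) ℚ.* x j)))
    ≡⟨ sum-cong-≗ (λ i → sym (yAx i)) ⟩
  sum (λ i → y i ℚ.* rowDot A i x)
    ≤⟨ sum-mono-≤ yAx≤yb ⟩
  sum (λ i → y i ℚ.* ι (b i))
    ≡⟨ sum-cong-≗ (λ i → ℚP.*-comm (y i) (ι (b i))) ⟩
  sum (λ i → ι (b i) ℚ.* y i)
    ≡⟨ Σℚ≡sum (λ i → ι (b i) ℚ.* y i) ⟨
  dotℚ b y ∎
  where
  open ℚP.≤-Reasoning
  open ℚΣ
  Aᵀy : ∀ j → sum (λ i → y i ℚ.* ι (A i j)) ≡ ι (c j)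
  Aᵀy j = trans (sym (Σℚ≡sum (λ i → y i ℚ.* ι (A i j)))) (Aᵀy≡c j)
  yAx : ∀ i → y i ℚ.* rowDot A i x ≡ sum (λ j → y i ℚ.* (ι (A i j) ℚ.* x j))
  yAx i = trans (cong (y i ℚ.*_) (Σℚ≡sum (λ j → ι (A i j) ℚ.* x j))) (*-distribˡ-sum (y i) (λ j → ι (A i j) ℚ.* x j))
  yAx≤yb : ∀ i → y i ℚ.* rowDot A i x ℚ.≤ y i ℚ.* ι (b i)
  yAx≤yb i = ℚP.*-monoˡ-≤-nonNeg (y i) {{ℚ.nonNegative (y≥0 i)}} (Ax≤b i)

∣i-1∣<∣i∣ : ∀ {i} → 1ℤ ℤ.≤ i → ℤ.∣ i ℤ.- 1ℤ ∣ ℕ.< ℤ.∣ i ∣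
∣i-1∣<∣i∣ {+[1+ n ]} _ = ℕP.≤-refl
∣i-1∣<∣i∣ {+ zero} (ℤ.+≤+ ())

∣i+1∣≤∣i∣ : ∀ {i} → i ℤ.< 0ℤ → ℤ.∣ i ℤ.+ 1ℤ ∣ ℕ.≤ ℤ.∣ i ∣
∣i+1∣≤∣i∣ { -[1+ zero ]} _ = ℕ.z≤n
∣i+1∣≤∣i∣ { -[1+ suc n ]} _ = ℕP.n≤1+n (suc n)
∣i+1∣≤∣i∣ {+ n} (ℤ.+<+ ())

∣∣-mono-< : ∀ {i j} → 0ℤ ℤ.≤ i → i ℤ.< j → ℤ.∣ i ∣ ℕ.< ℤ.∣ j ∣
∣∣-mono-< {+ m} {+ n} _ (ℤ.+<+ m<n) = m<n
∣∣-mono-< {+ m} { -[1+ n ]} _ ()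

-- nothing is the root, whose potential is fixed to 0.
Node : ℕ → Set
Node M = Maybe (Fin M)

at : ∀ {M} → (Fin M → ℤ) → Node M → ℤ
at p nothing = 0ℤ
at p (just v) = p v

negate : ∀ {M} → (Fin M → ℤ) → Fin M → ℤ
negate p v = ℤ.- p v

at-negate : ∀ {M} (p : Fin M → ℤ) u → at (negate p) u ≡ ℤ.- at p u
at-negate p nothing  = refl
at-negate p (just w) = refl

δ : ∀ {M} → Node M → Fin M → ℤ
δ nothing v = 0ℤ
δ (just u) v = if ⌊ u Fin.≟ v ⌋ then 1ℤ else 0ℤ

δ-same : ∀ {M} (u : Fin M) → δ (just u) u ≡ 1ℤ
δ-same u with u Fin.≟ u
... | yes _  = refl
... | no u≢u = ⊥-elim (u≢u refl)

δ-other : ∀ {M} {u v : Fin M} → u ≢ v → δ (just u) v ≡ 0ℤ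
δ-other {u = u} {v} u≢v with u Fin.≟ v
... | yes u≡v = ⊥-elim (u≢v u≡v)
... | no _    = refl

sum-δ* : ∀ {M} (u : Node M) (g : Fin M → ℤ) → ℤΣ.sum (λ v → δ u v ℤ.* g v) ≡ at g u
sum-δ* {M} nothing g = ℤΣ.sum-zero {M} (λ v → refl)
sum-δ* (just u) g = trans (ℤΣ.sum-δ (λ v → δ (just u) v ℤ.* g v) u off-diagonal)
                         (trans (cong (ℤ._* g u) (δ-same u)) (ℤP.*-identityˡ (g u)))
  where
  off-diagonal : ∀ v → v ≢ u → δ (just u) v ℤ.* g v ≡ 0ℤ
  off-diagonal v v≢u = cong (ℤ._* g v) (δ-other (v≢u ∘ sym))

sum-δ*-transpose : ∀ {M} (g : Fin M → ℤ) v → ℤΣ.sum (λ u → δ (just u) v ℤ.* g u) ≡ g v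
sum-δ*-transpose g v = trans (ℤΣ.sum-δ (λ u → δ (just u) v ℤ.* g u) v off-diagonal)
                             (trans (cong (ℤ._* g v) (δ-same v)) (ℤP.*-identityˡ (g v)))
  where
  off-diagonal : ∀ u → u ≢ v → δ (just u) v ℤ.* g u ≡ 0ℤ
  off-diagonal u u≢v = trans (cong (ℤ._* g u) (δ-other u≢v)) (ℤP.*-zeroˡ (g u))

sum-*δ : ∀ {M} (g : Fin M → ℤ) (u : Node M) → ℤΣ.sum (λ v → g v ℤ.* δ u v) ≡ at g u
sum-*δ g u = trans (ℤΣ.sum-cong-≗ (λ v → ℤP.*-comm (g v) (δ u v))) (sum-δ* u g)

infix 4 _∈ᴺ_ _∉ᴺ_ _∈ᴺ?_

_∈ᴺ_ : ∀ {M} → Node M → Subset M → Set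
nothing ∈ᴺ T = ⊤
just v ∈ᴺ T = v ∈ T

_∉ᴺ_ : ∀ {M} → Node M → Subset M → Set
u ∉ᴺ T = ¬ (u ∈ᴺ T)

_∈ᴺ?_ : ∀ {M} (u : Node M) (T : Subset M) → Dec (u ∈ᴺ T)
nothing ∈ᴺ? T = yes tt
just v ∈ᴺ? T = v ∈? T

∈ᴺ-mono : ∀ {M} {T T′ : Subset M} → T ⊆ T′ → ∀ {u} → u ∈ᴺ T → u ∈ᴺ T′
∈ᴺ-mono T⊆T′ {nothing} _ = tt
∈ᴺ-mono T⊆T′ {just w} w∈T = T⊆T′ w∈T

∉ᴺ⇒just : ∀ {M} {T : Subset M} u → u ∉ᴺ T → Σ[ w ∈ Fin M ] u ≡ just w × w ∉ T
∉ᴺ⇒just nothing  u∉T = ⊥-elim (u∉T tt)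
∉ᴺ⇒just (just w) w∉T = w , refl , w∉T

⊆-∪⁅⁆ : ∀ {M} {T : Subset M} {u} → T ⊆ T ∪ ⁅ u ⁆
⊆-∪⁅⁆ {u = u} = p⊆p∪q ⁅ u ⁆

∈-∪⁅⁆ : ∀ {M} {T : Subset M} u → just u ∈ᴺ T ∪ ⁅ u ⁆
∈-∪⁅⁆ u = x∈p∪q⁺ (inj₂ (x∈⁅x⁆ u))

⊂-∪⁅⁆ : ∀ {M} {T : Subset M} {u} → u ∉ T → T ⊂ T ∪ ⁅ u ⁆
⊂-∪⁅⁆ {u = u} u∉T = ⊆-∪⁅⁆ , u , ∈-∪⁅⁆ u , u∉T

∈ᴺ-∪⁅⁆⁻ : ∀ {M} {T : Subset M} {u} x → x ∈ᴺ T ∪ ⁅ u ⁆ → x ∉ᴺ T → x ≡ just u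
∈ᴺ-∪⁅⁆⁻ nothing _ x∉T = ⊥-elim (x∉T tt)
∈ᴺ-∪⁅⁆⁻ {T = T} {u} (just w) w∈ w∉T with x∈p∪q⁻ T ⁅ u ⁆ w∈
... | inj₁ w∈T = ⊥-elim (w∉T w∈T)
... | inj₂ w∈u = cong just (x∈⁅y⁆⇒x≡y u w∈u)

module Network {M k : ℕ} (tl hd : Fin k → Node M) where
  open import Data.Integer using (_+_; _-_; _*_)
  open ℤΣ using (sum)

  tension : (Fin M → ℤ) → Fin k → ℤ
  tension p e = at p (tl e) - at p (hd e)

  incidence : Fin k → Fin M → ℤ
  incidence e v = δ (tl e) v - δ (hd e) v

  divergence : (Fin k → ℕ) → Fin M → ℤ
  divergence y v = sum (λ e → + y e * incidence e v)

  sum-incidence* : ∀ e g → sum (λ v → incidence e v * g v) ≡ tension g e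
  sum-incidence* e g = begin
    sum (λ v → incidence e v * g v)
      ≡⟨ ℤΣ.sum-cong-≗ (λ v → ℤ[y-z]x≈yx-zx (g v) (δ (tl e) v) (δ (hd e) v)) ⟩
    sum (λ v → δ (tl e) v * g v - δ (hd e) v * g v)
      ≡⟨ ℤΣ.sum-sub (λ v → δ (tl e) v * g v) (λ v → δ (hd e) v * g v) ⟩
    sum (λ v → δ (tl e) v * g v) - sum (λ v → δ (hd e) v * g v)
      ≡⟨ cong₂ _-_ (sum-δ* (tl e) g) (sum-δ* (hd e) g) ⟩
    tension g e ∎
    where open ≡-Reasoning

  divergence-duality : ∀ y g → sum (λ v → divergence y v * g v) ≡ sum (λ e → + y e * tension g e)
  divergence-duality y g = begin
    sum (λ v → divergence y v * g v)
      ≡⟨ ℤΣ.sum-cong-≗ (λ v → ℤΣ.*-distribʳ-sum (g v) (λ e → + y e * incidence e v)) ⟩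
    sum (λ v → sum (λ e → + y e * incidence e v * g v))
      ≡⟨ ℤΣ.∑-comm (λ v e → + y e * incidence e v * g v) ⟩
    sum (λ e → sum (λ v → + y e * incidence e v * g v))
      ≡⟨ ℤΣ.sum-cong-≗ (λ e → ℤΣ.sum-cong-≗ (λ v → ℤP.*-assoc (+ y e) (incidence e v) (g v))) ⟩
    sum (λ e → sum (λ v → + y e * (incidence e v * g v)))
      ≡⟨ ℤΣ.sum-cong-≗ (λ e → sym (ℤΣ.*-distribˡ-sum (+ y e) (λ v → incidence e v * g v))) ⟩
    sum (λ e → + y e * sum (λ v → incidence e v * g v))
      ≡⟨ ℤΣ.sum-cong-≗ (λ e → cong (+ y e *_) (sum-incidence* e g)) ⟩
    sum (λ e → + y e * tension g e) ∎
    where open ≡-Reasoning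

  divergence-updateAt : ∀ y e f v →
    divergence (updateAt y e f) v ≡ divergence y v + (+ f (y e) - + y e) * incidence e v
  divergence-updateAt y e f v = begin
    divergence (updateAt y e f) v
      ≡⟨ sym (a-b+b (divergence (updateAt y e f) v) (divergence y v)) ⟩
    divergence y v + (divergence (updateAt y e f) v - divergence y v)
      ≡⟨ cong (λ z → divergence y v + z) (sym (ℤΣ.sum-sub (term (updateAt y e f)) (term y))) ⟩
    divergence y v + sum (λ e′ → term (updateAt y e f) e′ - term y e′)
      ≡⟨ cong (λ z → divergence y v + z) (ℤΣ.sum-δ _ e changed-only-at-e) ⟩
    divergence y v + (term (updateAt y e f) e - term y e)
      ≡⟨ cong (λ z → divergence y v + (+ z * incidence e v - term y e)) (updateAt-updates e y) ⟩
    divergence y v + (+ f (y e) * incidence e v - + y e * incidence e v)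
      ≡⟨ cong (λ z → divergence y v + z) (sym (ℤ[y-z]x≈yx-zx (incidence e v) (+ f (y e)) (+ y e))) ⟩
    divergence y v + (+ f (y e) - + y e) * incidence e v ∎
    where
    open ≡-Reasoning
    term : (Fin k → ℕ) → Fin k → ℤ
    term y′ e′ = + y′ e′ * incidence e′ v
    a-b+b : ∀ a b → b + (a - b) ≡ a
    a-b+b = solve-∀
    changed-only-at-e : ∀ e′ → e′ ≢ e → term (updateAt y e f) e′ - term y e′ ≡ 0ℤ
    changed-only-at-e e′ e′≢e =
      trans (cong (λ z → + z * incidence e′ v - term y e′) (updateAt-minimal e′ e y e′≢e)) (ℤP.+-inverseʳ (term y e′))

  divergence-push : ∀ y e v → divergence (updateAt y e suc) v ≡ divergence y v + incidence e v
  divergence-push y e v = trans (divergence-updateAt y e suc v) (d+[1+a-a]*i (divergence y v) (+ y e) (incidence e v))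
    where
    d+[1+a-a]*i : ∀ d a i → d + (1ℤ + a - a) * i ≡ d + i
    d+[1+a-a]*i = solve-∀

  divergence-pull : ∀ y e v → 0 ℕ.< y e → divergence (updateAt y e ℕ.pred) v ≡ divergence y v - incidence e v
  divergence-pull y e v y>0 = begin
    divergence (updateAt y e ℕ.pred) v
      ≡⟨ divergence-updateAt y e ℕ.pred v ⟩
    divergence y v + (+ ℕ.pred (y e) - + y e) * incidence e v
      ≡⟨ cong (λ z → divergence y v + z * incidence e v) (pred-sub y>0) ⟩
    divergence y v + ℤ.-1ℤ * incidence e v
      ≡⟨ d-1*i (divergence y v) (incidence e v) ⟩
    divergence y v - incidence e v ∎
    where
    open ≡-Reasoning
    pred-sub : ∀ {n} → 0 ℕ.< n → + ℕ.pred n - + n ≡ ℤ.-1ℤ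
    pred-sub {suc a} _ = a-[1+a] (+ a)
      where
      a-[1+a] : ∀ a → a - (1ℤ + a) ≡ ℤ.-1ℤ
      a-[1+a] = solve-∀
    d-1*i : ∀ d i → d + ℤ.-1ℤ * i ≡ d - i
    d-1*i = solve-∀

tension-negate : ∀ {M k} (tl hd : Fin k → Node M) q e → Network.tension tl hd (negate q) e ≡ Network.tension hd tl q e
tension-negate tl hd q e = trans (cong₂ ℤ._-_ (at-negate q (tl e)) (at-negate q (hd e))) (-a--b (at q (tl e)) (at q (hd e)))
  where
  -a--b : ∀ a b → ℤ.- a ℤ.- ℤ.- b ≡ b ℤ.- a
  -a--b = solve-∀

module PrimalDual {M k : ℕ} (tl hd : Fin k → Node M) (b : Fin k → ℤ) (c : Fin M → ℤ) where
  open import Data.Integer using (_+_; _-_; _*_; _≤_; _<_; ∣_∣)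
  open Network tl hd public
  open ℤΣ using (sum)

  Feasible : (Fin M → ℤ) → Set
  Feasible p = ∀ e → tension p e ≤ b e

  Tight : (Fin M → ℤ) → Fin k → Set
  Tight p e = tension p e ≡ b e

  Complementary : (Fin k → ℕ) → (Fin M → ℤ) → Set
  Complementary y p = ∀ e → 0 ℕ.< y e → Tight p e

  excess : (Fin k → ℕ) → Fin M → ℤ
  excess y v = c v - divergence y v

  objective : (Fin M → ℤ) → ℤ
  objective p = sum (λ v → c v * p v)

  imbalance : (Fin k → ℕ) → ℕ
  imbalance y = ℕΣ.sum (λ v → ∣ excess y v ∣)

  record State : Set where
    constructor state
    field
      flow : Fin k → ℕ
      potential : Fin M → ℤ
      feasible : Feasible potential
      complementary : Complementary flow potential
  open State public

  data Improvement (s : State) : State → Set where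
    imbalance-decreased : ∀ {s′} → objective (potential s′) ≡ objective (potential s) →
                          imbalance (flow s′) ℕ.< imbalance (flow s) → Improvement s s′
    objective-increased : ∀ {s′} → objective (potential s) < objective (potential s′) → Improvement s s′

  complementary-updateAt : ∀ {y p} e f → Complementary y p → Tight p e → Complementary (updateAt y e f) p
  complementary-updateAt {y} e f cs tight e′ y′>0 with e′ FinP.≟ e
  ... | yes refl = tight
  ... | no e′≢e  = cs e′ (subst (0 ℕ.<_) (updateAt-minimal e′ e y e′≢e) y′>0)

  cost≡objective : ∀ {y p} → Complementary y p → (∀ v → divergence y v ≡ c v) →
                   sum (λ e → b e * + y e) ≡ objective p
  cost≡objective {y} {p} cs div≡c = begin
    sum (λ e → b e * + y e)                ≡⟨ ℤΣ.sum-cong-≗ term ⟩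
    sum (λ e → + y e * tension p e)        ≡⟨ divergence-duality y p ⟨
    sum (λ v → divergence y v * p v)       ≡⟨ ℤΣ.sum-cong-≗ (λ v → cong (_* p v) (div≡c v)) ⟩
    objective p                            ∎
    where
    open ≡-Reasoning
    term : ∀ e → b e * + y e ≡ + y e * tension p e
    term e with y e in ye
    ... | zero  = ℤP.*-zeroʳ (b e)
    ... | suc n = trans (ℤP.*-comm (b e) (+ suc n)) (cong (+ suc n *_) (sym (cs e (subst (0 ℕ.<_) (sym ye) (ℕ.s≤s ℕ.z≤n)))))

  module Search {y p} (feasible : Feasible p) (complementary : Complementary y p)
                (v : Fin M) (1≤excess : 1ℤ ≤ excess y v) where

    Sink : Node M → Set
    Sink nothing  = ⊤
    Sink (just w) = excess y w < 0ℤ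

    -- y with one unit sent from u to a sink, changed only on arcs with both ends in T.
    record Route (T : Subset M) (u : Node M) : Set where
      field
        sink           : Node M
        isSink         : Sink sink
        flow′          : Fin k → ℕ
        complementary′ : Complementary flow′ p
        divergence′    : ∀ x → divergence flow′ x ≡ divergence y x + δ u x - δ sink x
        unchanged      : ∀ e → tl e ∉ᴺ T ⊎ hd e ∉ᴺ T → flow′ e ≡ y e

    Routable : Subset M → Set
    Routable T = (∀ w → excess y w < 0ℤ → w ∈ T) × (∀ u → u ∈ᴺ T → Route T u)

    Usable : Subset M → Fin k → Set
    Usable T e = (tl e ∉ᴺ T × hd e ∈ᴺ T × Tight p e) ⊎ (hd e ∉ᴺ T × tl e ∈ᴺ T × 0 ℕ.< y e)

    usable? : ∀ T e → Dec (Usable T e)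
    usable? T e = (¬? (tl e ∈ᴺ? T) ×-dec hd e ∈ᴺ? T ×-dec tension p e ℤP.≟ b e)
              ⊎-dec (¬? (hd e ∈ᴺ? T) ×-dec tl e ∈ᴺ? T ×-dec 0 ℕP.<? y e)

    Closed : Subset M → Set
    Closed T = ∀ e → ¬ Usable T e

    sink-route : ∀ {T u} → Sink u → Route T u
    sink-route {u = u} sink-u = record
      { sink = u ; isSink = sink-u ; flow′ = y ; complementary′ = complementary
      ; divergence′ = λ x → sym (d+i-i (divergence y x) (δ u x)) ; unchanged = λ _ _ → refl }
      where
      d+i-i : ∀ d i → d + i - i ≡ d
      d+i-i = solve-∀

    sinks : Subset M
    sinks = tabulate (λ w → isYes (excess y w ℤP.<? 0ℤ))

    ∈-sinks⁺ : ∀ {w} → excess y w < 0ℤ → w ∈ sinks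
    ∈-sinks⁺ {w} excess<0 = lookup⇒[]= w sinks (trans (lookup∘tabulate _ w) (Equivalence.to T-≡ (fromWitness excess<0)))

    ∈-sinks⁻ : ∀ {w} → w ∈ sinks → excess y w < 0ℤ
    ∈-sinks⁻ {w} w∈sinks = toWitness (Equivalence.from T-≡ (trans (sym (lookup∘tabulate _ w)) ([]=⇒lookup w∈sinks)))

    sinks-routable : Routable sinks
    sinks-routable = (λ _ → ∈-sinks⁺) , λ where
      nothing  _       → sink-route tt
      (just w) w∈sinks → sink-route (∈-sinks⁻ w∈sinks)

    open Route

    route-mono : ∀ {T T′ u} → T ⊆ T′ → Route T u → Route T′ u
    route-mono T⊆T′ r = record
      { sink = sink r ; isSink = isSink r ; flow′ = flow′ r ; complementary′ = complementary′ r ; divergence′ = divergence′ r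
      ; unchanged = λ e out → unchanged r e (Sum.map (_∘ ∈ᴺ-mono T⊆T′) (_∘ ∈ᴺ-mono T⊆T′) out) }

    unchanged-updateAt : ∀ {T u w e} (r : Route T w) f → tl e ∈ᴺ T ∪ ⁅ u ⁆ → hd e ∈ᴺ T ∪ ⁅ u ⁆ →
      ∀ e′ → tl e′ ∉ᴺ T ∪ ⁅ u ⁆ ⊎ hd e′ ∉ᴺ T ∪ ⁅ u ⁆ → updateAt (flow′ r) e f e′ ≡ y e′
    unchanged-updateAt {e = e} r f tl∈ hd∈ e′ out =
      trans (updateAt-minimal e′ e (flow′ r) e′≢e) (unchanged (route-mono ⊆-∪⁅⁆ r) e′ out)
      where
      e′≢e : e′ ≢ e
      e′≢e refl = Sum.[ (λ tl∉ → tl∉ tl∈) , (λ hd∉ → hd∉ hd∈) ] out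

    route-forward : ∀ {T u e} → Route T (hd e) → hd e ∈ᴺ T → Tight p e → tl e ≡ just u →
                    Route (T ∪ ⁅ u ⁆) (just u)
    route-forward {T} {u} {e} r hd∈T tight tl≡u = record
      { sink = sink r ; isSink = isSink r
      ; flow′ = updateAt (flow′ r) e suc
      ; complementary′ = complementary-updateAt e suc (complementary′ r) tight
      ; divergence′ = divergence″
      ; unchanged = unchanged-updateAt r suc (subst (_∈ᴺ T ∪ ⁅ u ⁆) (sym tl≡u) (∈-∪⁅⁆ u)) (∈ᴺ-mono ⊆-∪⁅⁆ hd∈T)
      }
      where
      telescope : ∀ d a b t → d + b - t + (a - b) ≡ d + a - t
      telescope = solve-∀
      divergence″ : ∀ x → divergence (updateAt (flow′ r) e suc) x ≡ divergence y x + δ (just u) x - δ (sink r) x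
      divergence″ x = begin
        divergence (updateAt (flow′ r) e suc) x
          ≡⟨ divergence-push (flow′ r) e x ⟩
        divergence (flow′ r) x + incidence e x
          ≡⟨ cong (_+ incidence e x) (divergence′ r x) ⟩
        divergence y x + δ (hd e) x - δ (sink r) x + (δ (tl e) x - δ (hd e) x)
          ≡⟨ telescope (divergence y x) (δ (tl e) x) (δ (hd e) x) (δ (sink r) x) ⟩
        divergence y x + δ (tl e) x - δ (sink r) x
          ≡⟨ cong (λ n → divergence y x + δ n x - δ (sink r) x) tl≡u ⟩
        divergence y x + δ (just u) x - δ (sink r) x ∎
        where open ≡-Reasoning

    route-backward : ∀ {T u e} → Route T (tl e) → tl e ∈ᴺ T → 0 ℕ.< y e → hd e ≡ just u → u ∉ T →
                     Route (T ∪ ⁅ u ⁆) (just u)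
    route-backward {T} {u} {e} r tl∈T y>0 hd≡u u∉T = record
      { sink = sink r ; isSink = isSink r
      ; flow′ = updateAt (flow′ r) e ℕ.pred
      ; complementary′ = complementary-updateAt e ℕ.pred (complementary′ r) (complementary e y>0)
      ; divergence′ = divergence″
      ; unchanged = unchanged-updateAt r ℕ.pred (∈ᴺ-mono ⊆-∪⁅⁆ tl∈T) (subst (_∈ᴺ T ∪ ⁅ u ⁆) (sym hd≡u) (∈-∪⁅⁆ u))
      }
      where
      flow′>0 : 0 ℕ.< flow′ r e
      flow′>0 = subst (0 ℕ.<_) (sym (unchanged r e (inj₂ (λ hd∈T → u∉T (subst (_∈ᴺ T) hd≡u hd∈T))))) y>0
      telescope : ∀ d a b t → d + a - t - (a - b) ≡ d + b - t
      telescope = solve-∀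
      divergence″ : ∀ x → divergence (updateAt (flow′ r) e ℕ.pred) x ≡ divergence y x + δ (just u) x - δ (sink r) x
      divergence″ x = begin
        divergence (updateAt (flow′ r) e ℕ.pred) x
          ≡⟨ divergence-pull (flow′ r) e x flow′>0 ⟩
        divergence (flow′ r) x - incidence e x
          ≡⟨ cong (_- incidence e x) (divergence′ r x) ⟩
        divergence y x + δ (tl e) x - δ (sink r) x - (δ (tl e) x - δ (hd e) x)
          ≡⟨ telescope (divergence y x) (δ (tl e) x) (δ (hd e) x) (δ (sink r) x) ⟩
        divergence y x + δ (hd e) x - δ (sink r) x
          ≡⟨ cong (λ n → divergence y x + δ n x - δ (sink r) x) hd≡u ⟩
        divergence y x + δ (just u) x - δ (sink r) x ∎
        where open ≡-Reasoning

    routable-∪⁅⁆ : ∀ {T u} → Routable T → Route (T ∪ ⁅ u ⁆) (just u) → Routable (T ∪ ⁅ u ⁆)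
    routable-∪⁅⁆ {T} (sinks⊆T , route) r = (λ w neg → ⊆-∪⁅⁆ (sinks⊆T w neg)) , route′
      where
      route′ : ∀ x → x ∈ᴺ T ∪ ⁅ _ ⁆ → Route (T ∪ ⁅ _ ⁆) x
      route′ x x∈ with x ∈ᴺ? T
      ... | yes x∈T = route-mono ⊆-∪⁅⁆ (route x x∈T)
      ... | no  x∉T = subst (Route _) (sym (∈ᴺ-∪⁅⁆⁻ x x∈ x∉T)) r

    enlarge : ∀ {T e} → Routable T → Usable T e → Σ[ u ∈ Fin M ] u ∉ T × Routable (T ∪ ⁅ u ⁆)
    enlarge {T} {e} routable@(_ , route) (inj₁ (tl∉T , hd∈T , tight)) with ∉ᴺ⇒just (tl e) tl∉T
    ... | u , tl≡u , u∉T = u , u∉T , routable-∪⁅⁆ routable (route-forward (route (hd e) hd∈T) hd∈T tight tl≡u)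
    enlarge {T} {e} routable@(_ , route) (inj₂ (hd∉T , tl∈T , y>0)) with ∉ᴺ⇒just (hd e) hd∉T
    ... | u , hd≡u , u∉T = u , u∉T , routable-∪⁅⁆ routable (route-backward (route (tl e) tl∈T) tl∈T y>0 hd≡u u∉T)

    explore : ∀ T → Routable T → Acc _⊃_ T → Σ[ T′ ∈ Subset M ] Routable T′ × Closed T′
    explore T routable (acc larger) with FinP.any? (usable? T)
    ... | no none = T , routable , λ e usable → none (e , usable)
    ... | yes (e , usable) with enlarge routable usable
    ...   | u , u∉T , routable′ = explore (T ∪ ⁅ u ⁆) routable′ (larger (⊂-∪⁅⁆ u∉T))

    sink-δ : ∀ t → Sink t → ∀ x → δ t x ≡ 0ℤ ⊎ (δ t x ≡ 1ℤ × excess y x < 0ℤ)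
    sink-δ nothing  _ x = inj₁ refl
    sink-δ (just t) t-sink x with t Fin.≟ x
    ... | yes refl = inj₂ (refl , t-sink)
    ... | no _     = inj₁ refl

    augment-imbalance : ∀ {T} (r : Route T (just v)) → imbalance (flow′ r) ℕ.< imbalance y
    augment-imbalance r = ℕΣ.sum-mono-< shrinks v shrinks-at-v
      where
      d-ε : ∀ c d a b → c - (d + a - b) ≡ c - d - a + b
      d-ε = solve-∀
      excess′ : ∀ x → excess (flow′ r) x ≡ excess y x - δ (just v) x + δ (sink r) x
      excess′ x = trans (cong (λ d → c x - d) (divergence′ r x)) (d-ε (c x) (divergence y x) (δ (just v) x) (δ (sink r) x))
      δ-sink-v : δ (sink r) v ≡ 0ℤ
      δ-sink-v with sink-δ (sink r) (isSink r) v
      ... | inj₁ δ≡0 = δ≡0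
      ... | inj₂ (_ , excess<0) = ⊥-elim (ℤP.<-asym excess<0 (ℤP.suc[i]≤j⇒i<j 1≤excess))
      shrinks-at-v : ∣ excess (flow′ r) v ∣ ℕ.< ∣ excess y v ∣
      shrinks-at-v rewrite excess′ v | δ-same v | δ-sink-v | ℤP.+-identityʳ (excess y v - 1ℤ) = ∣i-1∣<∣i∣ 1≤excess
      a-0+d : ∀ a d → a - 0ℤ + d ≡ a + d
      a-0+d = solve-∀
      shrinks : ∀ x → ∣ excess (flow′ r) x ∣ ℕ.≤ ∣ excess y x ∣
      shrinks x with x FinP.≟ v
      ... | yes refl = ℕP.<⇒≤ shrinks-at-v
      ... | no x≢v rewrite excess′ x | δ-other {u = v} (x≢v ∘ sym) | a-0+d (excess y x) (δ (sink r) x)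
            with sink-δ (sink r) (isSink r) x
      ...   | inj₁ δ≡0 rewrite δ≡0 | ℤP.+-identityʳ (excess y x) = ℕP.≤-refl
      ...   | inj₂ (δ≡1 , excess<0) rewrite δ≡1 = ∣i+1∣≤∣i∣ excess<0

    rise : Subset M → Node M → ℤ
    rise T u = if does (u ∈ᴺ? T) then 0ℤ else 1ℤ

    rise-∉ : ∀ {T u} → u ∉ᴺ T → rise T u ≡ 1ℤ
    rise-∉ {T} {u} u∉T rewrite dec-false (u ∈ᴺ? T) u∉T = refl

    raised : Subset M → Fin M → ℤ
    raised T w = p w + rise T (just w)

    tension-raised : ∀ T e → tension (raised T) e ≡ tension p e + (rise T (tl e) - rise T (hd e))
    tension-raised T e = trans (cong₂ _-_ (at-raised (tl e)) (at-raised (hd e)))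
                               (interchange (at p (tl e)) (at p (hd e)) (rise T (tl e)) (rise T (hd e)))
      where
      at-raised : ∀ u → at (raised T) u ≡ at p u + rise T u
      at-raised nothing  = refl
      at-raised (just w) = refl
      interchange : ∀ a b c d → a + c - (b + d) ≡ a - b + (c - d)
      interchange = solve-∀

    module _ {T} (closed : Closed T) where

      raised-feasible : Feasible (raised T)
      raised-feasible e rewrite tension-raised T e with tl e ∈ᴺ? T | hd e ∈ᴺ? T
      ... | yes _   | yes _   = ℤP.≤-trans (ℤP.≤-reflexive (ℤP.+-identityʳ _)) (feasible e)
      ... | no _    | no _    = ℤP.≤-trans (ℤP.≤-reflexive (ℤP.+-identityʳ _)) (feasible e)
      ... | yes _   | no _    = ℤP.i≤j⇒i-k≤j 1ℤ (feasible e)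
      ... | no tl∉  | yes hd∈ = subst (_≤ b e) (ℤP.+-comm 1ℤ (tension p e)) (ℤP.i<j⇒suc[i]≤j slack)
        where
        slack : tension p e < b e
        slack = ℤP.≤∧≢⇒< (feasible e) (λ tight → closed e (inj₁ (tl∉ , hd∈ , tight)))

      rise-balanced : ∀ e → 0 ℕ.< y e → rise T (tl e) ≡ rise T (hd e)
      rise-balanced e y>0 with tl e ∈ᴺ? T | hd e ∈ᴺ? T
      ... | yes _   | yes _   = refl
      ... | no _    | no _    = refl
      ... | yes tl∈ | no hd∉  = ⊥-elim (closed e (inj₂ (hd∉ , tl∈ , y>0)))
      ... | no tl∉  | yes hd∈ = ⊥-elim (closed e (inj₁ (tl∉ , hd∈ , complementary e y>0)))

      raised-complementary : Complementary y (raised T)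
      raised-complementary e y>0 = begin
        tension (raised T) e
          ≡⟨ tension-raised T e ⟩
        tension p e + (rise T (tl e) - rise T (hd e))
          ≡⟨ cong₂ _+_ (complementary e y>0) (ℤP.i≡j⇒i-j≡0 (rise-balanced e y>0)) ⟩
        b e + 0ℤ
          ≡⟨ ℤP.+-identityʳ (b e) ⟩
        b e ∎
        where open ≡-Reasoning

      divergence-rise : sum (λ w → divergence y w * rise T (just w)) ≡ 0ℤ
      divergence-rise = trans (divergence-duality y (rise T ∘ just)) (ℤΣ.sum-zero term)
        where
        at-rise : ∀ u → at (rise T ∘ just) u ≡ rise T u
        at-rise nothing  = refl
        at-rise (just w) = refl
        term : ∀ e → + y e * tension (rise T ∘ just) e ≡ 0ℤ
        term e with y e in ye
        ... | zero  = refl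
        ... | suc n = trans (cong (+ suc n *_) (trans (cong₂ _-_ (at-rise (tl e)) (at-rise (hd e))) (ℤP.i≡j⇒i-j≡0 balanced)))
                            (ℤP.*-zeroʳ (+ suc n))
          where
          balanced : rise T (tl e) ≡ rise T (hd e)
          balanced = rise-balanced e (subst (0 ℕ.<_) (sym ye) (ℕ.s≤s ℕ.z≤n))

      gain : ℤ
      gain = sum (λ w → excess y w * rise T (just w))

      cost-rise≡gain : sum (λ w → c w * rise T (just w)) ≡ gain
      cost-rise≡gain = begin
        sum (λ w → c w * rise T (just w))
          ≡⟨ ℤΣ.sum-cong-≗ split ⟩
        sum (λ w → excess y w * rise T (just w) + divergence y w * rise T (just w))
          ≡⟨ ℤΣ.∑-distrib-+ (λ w → excess y w * rise T (just w)) (λ w → divergence y w * rise T (just w)) ⟩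
        gain + sum (λ w → divergence y w * rise T (just w))
          ≡⟨ cong (λ z → gain + z) divergence-rise ⟩
        gain + 0ℤ
          ≡⟨ ℤP.+-identityʳ gain ⟩
        gain ∎
        where
        open ≡-Reasoning
        c-d+d : ∀ c d r → (c - d) * r + d * r ≡ c * r
        c-d+d = solve-∀
        split : ∀ w → c w * rise T (just w) ≡ excess y w * rise T (just w) + divergence y w * rise T (just w)
        split w = sym (c-d+d (c w) (divergence y w) (rise T (just w)))

      objective-raised : objective (raised T) ≡ objective p + gain
      objective-raised = begin
        objective (raised T)
          ≡⟨ ℤΣ.sum-cong-≗ (λ w → ℤP.*-distribˡ-+ (c w) (p w) (rise T (just w))) ⟩
        sum (λ w → c w * p w + c w * rise T (just w))
          ≡⟨ ℤΣ.∑-distrib-+ (λ w → c w * p w) (λ w → c w * rise T (just w)) ⟩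
        objective p + sum (λ w → c w * rise T (just w))
          ≡⟨ cong (λ z → objective p + z) cost-rise≡gain ⟩
        objective p + gain ∎
        where open ≡-Reasoning

      1≤gain : (∀ w → excess y w < 0ℤ → w ∈ T) → v ∉ T → 1ℤ ≤ gain
      1≤gain sinks⊆T v∉T = ℤP.≤-trans (subst (1ℤ ≤_) (sym at-v) 1≤excess) (ℤΣ.≤-sum v nonneg)
        where
        at-v : excess y v * rise T (just v) ≡ excess y v
        at-v = trans (cong (excess y v *_) (rise-∉ v∉T)) (ℤP.*-identityʳ (excess y v))
        nonneg : ∀ w → 0ℤ ≤ excess y w * rise T (just w)
        nonneg w with w ∈? T
        ... | yes _  = ℤP.≤-reflexive (sym (ℤP.*-zeroʳ (excess y w)))
        ... | no w∉T = subst (0ℤ ≤_) (sym (ℤP.*-identityʳ (excess y w))) (ℤP.≮⇒≥ (w∉T ∘ sinks⊆T w))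

      raised-objective : (∀ w → excess y w < 0ℤ → w ∈ T) → v ∉ T → objective p < objective (raised T)
      raised-objective sinks⊆T v∉T = subst (objective p <_) (sym objective-raised) (ℤP.suc[i]≤j⇒i<j 1+objective≤)
        where
        1+objective≤ : 1ℤ + objective p ≤ objective p + gain
        1+objective≤ = subst (_≤ objective p + gain) (ℤP.+-comm (objective p) 1ℤ)
                             (ℤP.+-monoʳ-≤ (objective p) (1≤gain sinks⊆T v∉T))

    improve : Σ State (Improvement (state y p feasible complementary))
    improve with explore sinks sinks-routable (⊃-wellFounded sinks)
    ... | T , (sinks⊆T , route) , closed with v ∈? T
    ...   | yes v∈T = state (flow′ r) p feasible (complementary′ r) , imbalance-decreased refl (augment-imbalance r)
      where
      r : Route T (just v)
      r = route (just v) v∈T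
    ...   | no v∉T  = state y (raised T) (raised-feasible closed) (raised-complementary closed)
                    , objective-increased (raised-objective closed sinks⊆T v∉T)

module PrimalDualMethod {M k : ℕ} (tl hd : Fin k → Node M) (b : Fin k → ℤ) (c : Fin M → ℤ) where
  open import Data.Integer using (_+_; _-_; -_; _*_; _≤_; _<_; ∣_∣)
  open PrimalDual tl hd b c public
  -- Negative excess for c is positive excess for −c in the reversed network, with negated potentials.
  private
    module R = PrimalDual hd tl b (λ v → - c v)

  reversed-excess : ∀ y v → R.excess y v ≡ - excess y v
  reversed-excess y v = trans (cong (λ d → - c v - d) reversed-divergence) (-c--d (c v) (divergence y v))
    where
    -c--d : ∀ c d → - c - - d ≡ - (c - d)
    -c--d = solve-∀
    reversed-divergence : R.divergence y v ≡ - divergence y v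
    reversed-divergence = trans (ℤΣ.sum-cong-≗ term) (ℤΣ.sum-neg (λ e → + y e * incidence e v))
      where
      b-a : ∀ a b → b - a ≡ - (a - b)
      b-a = solve-∀
      term : ∀ e → + y e * R.incidence e v ≡ - (+ y e * incidence e v)
      term e = trans (cong (+ y e *_) (b-a (δ (tl e) v) (δ (hd e) v))) (sym (ℤP.neg-distribʳ-* (+ y e) (incidence e v)))

  reversed-objective : ∀ q → R.objective q ≡ objective (negate q)
  reversed-objective q = ℤΣ.sum-cong-≗ (λ v → trans (sym (ℤP.neg-distribˡ-* (c v) (q v))) (ℤP.neg-distribʳ-* (c v) (q v)))

  objective-involutive : ∀ p → objective (negate (negate p)) ≡ objective p
  objective-involutive p = ℤΣ.sum-cong-≗ (λ v → cong (c v *_) (ℤP.neg-involutive (p v)))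

  reversed-imbalance : ∀ y → R.imbalance y ≡ imbalance y
  reversed-imbalance y = ℕΣ.sum-cong-≗ (λ v → trans (cong ∣_∣ (reversed-excess y v)) (ℤP.∣-i∣≡∣i∣ (excess y v)))

  reverse : State → R.State
  reverse s = R.state (flow s) (negate (potential s))
    (λ e → subst (_≤ b e) (sym (tension-negate hd tl (potential s) e)) (feasible s e))
    (λ e y>0 → trans (tension-negate hd tl (potential s) e) (complementary s e y>0))

  unreverse : R.State → State
  unreverse s = state (R.flow s) (negate (R.potential s))
    (λ e → subst (_≤ b e) (sym (tension-negate tl hd (R.potential s) e)) (R.feasible s e))
    (λ e y>0 → trans (tension-negate tl hd (R.potential s) e) (R.complementary s e y>0))

  unreverse-improvement : ∀ s {s′} → R.Improvement (reverse s) s′ → Improvement s (unreverse s′)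
  unreverse-improvement s {s′} (R.imbalance-decreased obj≡ imbalance<) = imbalance-decreased
    (trans (sym (reversed-objective (R.potential s′))) (trans obj≡ (trans (reversed-objective _) (objective-involutive (potential s)))))
    (subst₂ ℕ._<_ (reversed-imbalance (R.flow s′)) (reversed-imbalance (flow s)) imbalance<)
  unreverse-improvement s {s′} (R.objective-increased objective<) = objective-increased
    (subst₂ _<_ (trans (reversed-objective _) (objective-involutive (potential s))) (reversed-objective (R.potential s′)) objective<)

  improve : ∀ s v → excess (flow s) v ≢ 0ℤ → Σ State (Improvement s)
  improve s v excess≢0 with ℤP.<-cmp (excess (flow s) v) 0ℤ
  ... | tri> _ _ excess>0 = Search.improve (feasible s) (complementary s) v (ℤP.i<j⇒suc[i]≤j excess>0)
  ... | tri≈ _ excess≡0 _ = ⊥-elim (excess≢0 excess≡0)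
  ... | tri< excess<0 _ _ =
    unreversed (R.Search.improve (R.feasible (reverse s)) (R.complementary (reverse s)) v 1≤reversed-excess)
    where
    1≤reversed-excess : 1ℤ ≤ R.excess (flow s) v
    1≤reversed-excess = subst (1ℤ ≤_) (sym (reversed-excess (flow s) v)) (ℤP.i<j⇒suc[i]≤j (ℤP.neg-mono-< excess<0))
    unreversed : Σ R.State (R.Improvement (reverse s)) → Σ State (Improvement s)
    unreversed (s′ , improvement) = unreverse s′ , unreverse-improvement s improvement

  module _ (B : ℤ) (bounded : ∀ p → Feasible p → objective p ≤ B) where

    _⊏_ : ℕ × ℕ → ℕ × ℕ → Set
    _⊏_ = ×-Lex _≡_ ℕ._<_ ℕ._<_

    measure : State → ℕ × ℕ
    measure s = ∣ B - objective (potential s) ∣ , imbalance (flow s)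

    gap-shrinks : ∀ {a a′} → a′ ≤ B → a < a′ → ∣ B - a′ ∣ ℕ.< ∣ B - a ∣
    gap-shrinks a′≤B a<a′ = ∣∣-mono-< (ℤP.i≤j⇒0≤j-i a′≤B) (ℤP.+-monoʳ-< B (ℤP.neg-mono-< a<a′))

    balance : (s : State) → Acc _⊏_ (measure s) → Σ[ s′ ∈ State ] (∀ v → divergence (flow s′) v ≡ c v)
    balance s (acc smaller) with FinP.all? (λ v → excess (flow s) v ℤP.≟ 0ℤ)
    ... | yes balanced = s , λ v → sym (ℤP.i-j≡0⇒i≡j (c v) (divergence (flow s) v) (balanced v))
    ... | no unbalanced with FinP.¬∀⟶∃¬ M _ (λ v → excess (flow s) v ℤP.≟ 0ℤ) unbalanced
    ...   | v , excess≢0 with improve s v excess≢0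
    ...     | s′ , imbalance-decreased objective≡ imbalance< =
                balance s′ (smaller (inj₂ (cong (λ a → ∣ B - a ∣) objective≡ , imbalance<)))
    ...     | s′ , objective-increased objective< =
                balance s′ (smaller (inj₁ (gap-shrinks (bounded (potential s′) (feasible s′)) objective<)))

    optimal-pair : ∀ p₀ → Feasible p₀ → Σ[ s ∈ State ] (∀ v → divergence (flow s) v ≡ c v)
    optimal-pair p₀ feasible₀ = balance s₀ (×-wellFounded <-wellFounded <-wellFounded (measure s₀))
      where
      s₀ : State
      s₀ = state (λ _ → 0) p₀ feasible₀ (λ e ())

-- A = D V for the arc–node incidence matrix D of a rooted digraph and a unimodular V with rows
-- row w; coordinates p = V⁻¹ p and costs c = (V⁻¹)ᵀ c.
record NetworkForm {k d : ℕ} (A : Matrix k d) : Set where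
  field
    nodes             : ℕ
    tail head         : Fin k → Node nodes
    row               : Fin nodes → Fin d → ℤ
    coordinates       : (Fin nodes → ℤ) → Fin d → ℤ
    costs             : (Fin d → ℤ) → Fin nodes → ℤ
    A≡tension         : ∀ i j → A i j ≡ at (λ w → row w j) (tail i) ℤ.- at (λ w → row w j) (head i)
    row-coordinates   : ∀ p w → ℤΣ.sum (λ j → row w j ℤ.* coordinates p j) ≡ p w
    costs-coordinates : ∀ c p → ℤΣ.sum (λ j → c j ℤ.* coordinates p j) ≡ ℤΣ.sum (λ w → costs c w ℤ.* p w)
    costs-row         : ∀ c j → ℤΣ.sum (λ w → costs c w ℤ.* row w j) ≡ c j

module NetworkFormTDI {k d} {A : Matrix k d} (N : NetworkForm A) (b : Fin k → ℤ) (c : Fin d → ℤ) where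
  open NetworkForm N
  open PrimalDualMethod tail head b (costs c)
  open import Data.Integer using (_+_; _-_; _*_; _≤_)

  column : Fin d → Fin nodes → ℤ
  column j w = row w j

  potentialℚ : (Fin d → ℚ) → Node nodes → ℚ
  potentialℚ x u = ℚΣ.sum (λ j → ι (at (column j) u) ℚ.* x j)

  potentialℚ-root : ∀ x → potentialℚ x nothing ≡ 0ℚ
  potentialℚ-root x = ℚΣ.sum-zero {d} (λ j → ℚP.*-zeroˡ (x j))

  rowDot≡ : ∀ x i → rowDot A i x ≡ potentialℚ x (tail i) ℚ.- potentialℚ x (head i)
  rowDot≡ x i = begin
    rowDot A i x
      ≡⟨ Σℚ≡sum (λ j → ι (A i j) ℚ.* x j) ⟩
    ℚΣ.sum (λ j → ι (A i j) ℚ.* x j)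
      ≡⟨ ℚΣ.sum-cong-≗ term ⟩
    ℚΣ.sum (λ j → ι (at (column j) (tail i)) ℚ.* x j ℚ.- ι (at (column j) (head i)) ℚ.* x j)
      ≡⟨ ℚΣ.sum-sub (λ j → ι (at (column j) (tail i)) ℚ.* x j) (λ j → ι (at (column j) (head i)) ℚ.* x j) ⟩
    potentialℚ x (tail i) ℚ.- potentialℚ x (head i) ∎
    where
    open ≡-Reasoning
    term : ∀ j → ι (A i j) ℚ.* x j ≡ ι (at (column j) (tail i)) ℚ.* x j ℚ.- ι (at (column j) (head i)) ℚ.* x j
    term j = trans (cong (λ a → ι a ℚ.* x j) (A≡tension i j))
                   (trans (cong (ℚ._* x j) (ι-- (at (column j) (tail i)) (at (column j) (head i))))
                          (ℚ[y-z]x≈yx-zx (x j) (ι (at (column j) (tail i))) (ι (at (column j) (head i)))))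

  potentialℚ-coordinates : ∀ p u → potentialℚ (ι ∘ coordinates p) u ≡ ι (at p u)
  potentialℚ-coordinates p u = trans (sum-ι* (λ j → at (column j) u) (coordinates p)) (cong ι (at-row-coordinates u))
    where
    at-row-coordinates : ∀ u → ℤΣ.sum (λ j → at (column j) u * coordinates p j) ≡ at p u
    at-row-coordinates nothing  = ℤΣ.sum-zero {d} (λ j → ℤP.*-zeroˡ (coordinates p j))
    at-row-coordinates (just w) = row-coordinates p w

  feasible⇒primal : ∀ {p} → Feasible p → PrimalFeasible A b (ι ∘ coordinates p)
  feasible⇒primal {p} feasible-p i = begin
    rowDot A i (ι ∘ coordinates p)
      ≡⟨ rowDot≡ (ι ∘ coordinates p) i ⟩
    potentialℚ (ι ∘ coordinates p) (tail i) ℚ.- potentialℚ (ι ∘ coordinates p) (head i)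
      ≡⟨ cong₂ ℚ._-_ (potentialℚ-coordinates p (tail i)) (potentialℚ-coordinates p (head i)) ⟩
    ι (at p (tail i)) ℚ.- ι (at p (head i))
      ≡⟨ ι-- (at p (tail i)) (at p (head i)) ⟨
    ι (tension p i)
      ≤⟨ ι-mono-≤ (feasible-p i) ⟩
    ι (b i) ∎
    where open ℚP.≤-Reasoning

  dotℚ-coordinates : ∀ p → dotℚ c (ι ∘ coordinates p) ≡ ι (objective p)
  dotℚ-coordinates p = trans (Σℚ-ι* c (coordinates p)) (cong ι (costs-coordinates c p))

  primal⇒feasible : ∀ {x} → PrimalFeasible A b x → Feasible (λ w → ℚ.floor (potentialℚ x (just w)))
  primal⇒feasible {x} Ax≤b i = subst₂ (λ t h → t - h ≤ b i) (at-floor (tail i)) (at-floor (head i))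
    (floor-sub-≤ (potentialℚ x (tail i)) (potentialℚ x (head i)) (b i) (subst (ℚ._≤ ι (b i)) (rowDot≡ x i) (Ax≤b i)))
    where
    at-floor : ∀ u → ℚ.floor (potentialℚ x u) ≡ at (λ w → ℚ.floor (potentialℚ x (just w))) u
    at-floor nothing  = cong ℚ.floor (potentialℚ-root x)
    at-floor (just w) = refl

  bounded : ∀ B → (∀ x → PrimalFeasible A b x → dotℚ c x ℚ.≤ B) → ∀ p → Feasible p → objective p ≤ ℚ.floor B
  bounded B bound p feasible-p =
    subst (objective p ≤_) (ℤP.pred-suc (ℚ.floor B)) (ℤP.i<j⇒i≤pred[j] (ι-cancel-< {b = ℤ.suc (ℚ.floor B)} below))
    where
    open ℚP.≤-Reasoning
    below : ι (objective p) ℚ.< ι (ℤ.suc (ℚ.floor B))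
    below = begin-strict
      ι (objective p)                   ≡⟨ dotℚ-coordinates p ⟨
      dotℚ c (ι ∘ coordinates p)        ≤⟨ bound (ι ∘ coordinates p) (feasible⇒primal feasible-p) ⟩
      B                                 <⟨ <-suc-floor B ⟩
      ι (ℤ.suc (ℚ.floor B))             ∎

  dual-feasible : ∀ {y} → (∀ w → divergence y w ≡ costs c w) → DualFeasible A c (λ i → ι (+ y i))
  dual-feasible {y} divergence≡costs = (λ i → ι-mono-≤ {b = + y i} (ℤ.+≤+ ℕ.z≤n)) ,
    λ j → trans (Σℚ-ι* (λ i → + y i) (λ i → A i j)) (cong ι (begin
    ℤΣ.sum (λ i → + y i * A i j)
      ≡⟨ ℤΣ.sum-cong-≗ (λ i → cong (+ y i *_) (A≡tension i j)) ⟩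
    ℤΣ.sum (λ i → + y i * tension (column j) i)
      ≡⟨ divergence-duality y (column j) ⟨
    ℤΣ.sum (λ w → divergence y w * row w j)
      ≡⟨ ℤΣ.sum-cong-≗ (λ w → cong (_* row w j) (divergence≡costs w)) ⟩
    ℤΣ.sum (λ w → costs c w * row w j)
      ≡⟨ costs-row c j ⟩
    c j ∎))
    where open ≡-Reasoning

  integral-dual-optimum : PrimalMaxFinite A b c → Σ[ y ∈ (Fin k → ℤ) ] DualOptimal A b c (λ i → ι (y i))
  integral-dual-optimum ((x₀ , Ax₀≤b) , (B , bound)) =
    dual-optimum (optimal-pair (ℚ.floor B) (bounded B bound) (λ w → ℚ.floor (potentialℚ x₀ (just w)))
                               (primal⇒feasible Ax₀≤b))
    where
    dual-optimum : Σ[ s ∈ State ] (∀ w → divergence (flow s) w ≡ costs c w) →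
                   Σ[ y ∈ (Fin k → ℤ) ] DualOptimal A b c (λ i → ι (y i))
    dual-optimum (s , divergence≡costs) = (λ i → + flow s i) , dual-feasible {flow s} divergence≡costs , optimal
      where
      optimal : ∀ y′ → DualFeasible A c y′ → dotℚ b (λ i → ι (+ flow s i)) ℚ.≤ dotℚ b y′
      optimal y′ dual-y′ = begin
        dotℚ b (λ i → ι (+ flow s i))
          ≡⟨ Σℚ-ι* b (λ i → + flow s i) ⟩
        ι (ℤΣ.sum (λ i → b i * + flow s i))
          ≡⟨ cong ι (cost≡objective (complementary s) divergence≡costs) ⟩
        ι (objective (potential s))
          ≡⟨ dotℚ-coordinates (potential s) ⟨
        dotℚ c (ι ∘ coordinates (potential s))
          ≤⟨ weak-duality A b c (feasible⇒primal (feasible s)) dual-y′ ⟩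
        dotℚ b y′ ∎
        where open ℚP.≤-Reasoning

networkForm⇒TDI : ∀ {k d} {A : Matrix k d} → NetworkForm A → ∀ b → TDI A b
networkForm⇒TDI N b c = NetworkFormTDI.integral-dual-optimum N b c

concatMap⁺ : ∀ {A B : Set} {P : B → Set} {f : A → List B} → (∀ x → All P (f x)) → ∀ xs → All P (List.concatMap f xs)
concatMap⁺ P-f xs = concat⁺ (map⁺ (All.universal P-f xs))

if⁺ : ∀ {A : Set} {P : A → Set} (c : Bool) {a} → P a → All P (if c then a ∷ [] else [])
if⁺ true  Pa = Pa ∷ []
if⁺ false Pa = []

-- The node L z stands for ℓ_z and R z for r_z = ℓ_z + ρ_z.
module IntervalOrderMatrix (n : ℕ) where
  open import Data.Integer using (_+_; _-_; -_; _*_)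
  open ℤΣ using (sum)

  L R : Fin n → Fin (n ℕ.+ n)
  L z = z ↑ˡ n
  R z = n ↑ʳ z

  ↑-elim : ∀ {P : Fin (n ℕ.+ n) → Set} → (∀ z → P (L z)) → (∀ z → P (R z)) → ∀ w → P w
  ↑-elim {P} P-L P-R w with splitAt n w in split≡
  ... | inj₁ z = subst P (FinP.splitAt⁻¹-↑ˡ split≡) (P-L z)
  ... | inj₂ z = subst P (FinP.splitAt⁻¹-↑ʳ split≡) (P-R z)

  sum-↑ : ∀ (f : Fin (n ℕ.+ n) → ℤ) → sum f ≡ sum (f ∘ L) + sum (f ∘ R)
  sum-↑ = ℤΣ.sum-↑ n

  eℓ-L : ∀ x z → eℓ {n} x (L z) ≡ δ (just z) x
  eℓ-L x z rewrite FinP.splitAt-↑ˡ n z n = refl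

  eℓ-R : ∀ x z → eℓ {n} x (R z) ≡ 0ℤ
  eℓ-R x z rewrite FinP.splitAt-↑ʳ n n z = refl

  eρ-L : ∀ x z → eρ {n} x (L z) ≡ 0ℤ
  eρ-L x z rewrite FinP.splitAt-↑ˡ n z n = refl

  eρ-R : ∀ x z → eρ {n} x (R z) ≡ δ (just z) x
  eρ-R x z rewrite FinP.splitAt-↑ʳ n n z = refl

  sum-eℓ* : ∀ z (f : Fin (n ℕ.+ n) → ℤ) → sum (λ j → eℓ {n} z j * f j) ≡ f (L z)
  sum-eℓ* z f = begin
    sum (λ j → eℓ z j * f j)                                                  ≡⟨ sum-↑ (λ j → eℓ z j * f j) ⟩
    sum (λ z′ → eℓ z (L z′) * f (L z′)) + sum (λ z′ → eℓ z (R z′) * f (R z′)) ≡⟨ cong₂ _+_ on-L on-R ⟩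
    f (L z) + 0ℤ                                                              ≡⟨ ℤP.+-identityʳ (f (L z)) ⟩
    f (L z)                                                                   ∎
    where
    open ≡-Reasoning
    on-L : sum (λ z′ → eℓ z (L z′) * f (L z′)) ≡ f (L z)
    on-L = trans (ℤΣ.sum-cong-≗ (λ z′ → cong (_* f (L z′)) (eℓ-L z z′))) (sum-δ*-transpose (f ∘ L) z)
    on-R : sum (λ z′ → eℓ z (R z′) * f (R z′)) ≡ 0ℤ
    on-R = ℤΣ.sum-zero {n} (λ z′ → trans (cong (_* f (R z′)) (eℓ-R z z′)) (ℤP.*-zeroˡ (f (R z′))))

  sum-eρ* : ∀ z (f : Fin (n ℕ.+ n) → ℤ) → sum (λ j → eρ {n} z j * f j) ≡ f (R z)
  sum-eρ* z f = begin
    sum (λ j → eρ z j * f j)                                                  ≡⟨ sum-↑ (λ j → eρ z j * f j) ⟩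
    sum (λ z′ → eρ z (L z′) * f (L z′)) + sum (λ z′ → eρ z (R z′) * f (R z′)) ≡⟨ cong₂ _+_ on-L on-R ⟩
    0ℤ + f (R z)                                                              ≡⟨ ℤP.+-identityˡ (f (R z)) ⟩
    f (R z)                                                                   ∎
    where
    open ≡-Reasoning
    on-L : sum (λ z′ → eρ z (L z′) * f (L z′)) ≡ 0ℤ
    on-L = ℤΣ.sum-zero {n} (λ z′ → trans (cong (_* f (L z′)) (eρ-L z z′)) (ℤP.*-zeroˡ (f (L z′))))
    on-R : sum (λ z′ → eρ z (R z′) * f (R z′)) ≡ f (R z)
    on-R = trans (ℤΣ.sum-cong-≗ (λ z′ → cong (_* f (R z′)) (eρ-R z z′))) (sum-δ*-transpose (f ∘ R) z)

  row : Fin (n ℕ.+ n) → Row n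
  row = eℓ {n} VecF.++ (λ z → _⊕_ {n} (eℓ z) (eρ z))

  row-L : ∀ z j → row (L z) j ≡ eℓ z j
  row-L z j = cong (λ ρ → ρ j) (lookup-++ˡ {n = n} (eℓ {n}) (λ z → _⊕_ {n} (eℓ z) (eρ z)) z)

  row-R : ∀ z j → row (R z) j ≡ eℓ z j + eρ z j
  row-R z j = cong (λ ρ → ρ j) (lookup-++ʳ {m = n} (eℓ {n}) (λ z → _⊕_ {n} (eℓ z) (eρ z)) z)

  row-L-L : ∀ z z₀ → row (L z) (L z₀) ≡ δ (just z₀) z
  row-L-L z z₀ = trans (row-L z (L z₀)) (eℓ-L z z₀)

  row-L-R : ∀ z z₀ → row (L z) (R z₀) ≡ 0ℤ
  row-L-R z z₀ = trans (row-L z (R z₀)) (eℓ-R z z₀)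

  row-R-L : ∀ z z₀ → row (R z) (L z₀) ≡ δ (just z₀) z
  row-R-L z z₀ = trans (row-R z (L z₀)) (trans (cong₂ _+_ (eℓ-L z z₀) (eρ-L z z₀)) (ℤP.+-identityʳ _))

  row-R-R : ∀ z z₀ → row (R z) (R z₀) ≡ δ (just z₀) z
  row-R-R z z₀ = trans (row-R z (R z₀)) (trans (cong₂ _+_ (eℓ-R z z₀) (eρ-R z z₀)) (ℤP.+-identityˡ _))

  coordinates : (Fin (n ℕ.+ n) → ℤ) → Fin (n ℕ.+ n) → ℤ
  coordinates p = (λ z → p (L z)) VecF.++ (λ z → p (R z) - p (L z))

  costs : (Fin (n ℕ.+ n) → ℤ) → Fin (n ℕ.+ n) → ℤ
  costs c = (λ z → c (L z) - c (R z)) VecF.++ (λ z → c (R z))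

  row-coordinates : ∀ p w → sum (λ j → row w j * coordinates p j) ≡ p w
  row-coordinates p = ↑-elim on-L on-R
    where
    open ≡-Reasoning
    coordinates-L : ∀ z → coordinates p (L z) ≡ p (L z)
    coordinates-L = lookup-++ˡ {n = n} (λ z → p (L z)) (λ z → p (R z) - p (L z))
    coordinates-R : ∀ z → coordinates p (R z) ≡ p (R z) - p (L z)
    coordinates-R = lookup-++ʳ {m = n} (λ z → p (L z)) (λ z → p (R z) - p (L z))
    on-L : ∀ z → sum (λ j → row (L z) j * coordinates p j) ≡ p (L z)
    on-L z = begin
      sum (λ j → row (L z) j * coordinates p j)
        ≡⟨ ℤΣ.sum-cong-≗ (λ j → cong (_* coordinates p j) (row-L z j)) ⟩
      sum (λ j → eℓ z j * coordinates p j)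
        ≡⟨ sum-eℓ* z (coordinates p) ⟩
      coordinates p (L z)
        ≡⟨ coordinates-L z ⟩
      p (L z) ∎
    on-R : ∀ z → sum (λ j → row (R z) j * coordinates p j) ≡ p (R z)
    on-R z = begin
      sum (λ j → row (R z) j * coordinates p j)
        ≡⟨ ℤΣ.sum-cong-≗ (λ j → trans (cong (_* coordinates p j) (row-R z j))
                                       (ℤP.*-distribʳ-+ (coordinates p j) (eℓ z j) (eρ z j))) ⟩
      sum (λ j → eℓ z j * coordinates p j + eρ z j * coordinates p j)
        ≡⟨ ℤΣ.∑-distrib-+ (λ j → eℓ z j * coordinates p j) (λ j → eρ z j * coordinates p j) ⟩
      sum (λ j → eℓ z j * coordinates p j) + sum (λ j → eρ z j * coordinates p j)
        ≡⟨ cong₂ _+_ (sum-eℓ* z (coordinates p)) (sum-eρ* z (coordinates p)) ⟩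
      coordinates p (L z) + coordinates p (R z)
        ≡⟨ cong₂ _+_ (coordinates-L z) (coordinates-R z) ⟩
      p (L z) + (p (R z) - p (L z))
        ≡⟨ a+[b-a] (p (L z)) (p (R z)) ⟩
      p (R z) ∎
      where
      a+[b-a] : ∀ a b → a + (b - a) ≡ b
      a+[b-a] = solve-∀

  costs-coordinates : ∀ c p → sum (λ j → c j * coordinates p j) ≡ sum (λ w → costs c w * p w)
  costs-coordinates c p = begin
    sum (λ j → c j * coordinates p j)
      ≡⟨ sum-↑ (λ j → c j * coordinates p j) ⟩
    sum (λ z → c (L z) * coordinates p (L z)) + sum (λ z → c (R z) * coordinates p (R z))
      ≡⟨ ℤΣ.∑-distrib-+ (λ z → c (L z) * coordinates p (L z)) (λ z → c (R z) * coordinates p (R z)) ⟨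
    sum (λ z → c (L z) * coordinates p (L z) + c (R z) * coordinates p (R z))
      ≡⟨ ℤΣ.sum-cong-≗ regroup ⟩
    sum (λ z → costs c (L z) * p (L z) + costs c (R z) * p (R z))
      ≡⟨ ℤΣ.∑-distrib-+ (λ z → costs c (L z) * p (L z)) (λ z → costs c (R z) * p (R z)) ⟩
    sum (λ z → costs c (L z) * p (L z)) + sum (λ z → costs c (R z) * p (R z))
      ≡⟨ sum-↑ (λ w → costs c w * p w) ⟨
    sum (λ w → costs c w * p w) ∎
    where
    open ≡-Reasoning
    a*x+b*[y-x] : ∀ a b x y → a * x + b * (y - x) ≡ (a - b) * x + b * y
    a*x+b*[y-x] = solve-∀
    regroup : ∀ z → c (L z) * coordinates p (L z) + c (R z) * coordinates p (R z) ≡ costs c (L z) * p (L z) + costs c (R z) * p (R z)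
    regroup z rewrite lookup-++ˡ {n = n} (λ z → p (L z)) (λ z → p (R z) - p (L z)) z
                    | lookup-++ʳ {m = n} (λ z → p (L z)) (λ z → p (R z) - p (L z)) z
                    | lookup-++ˡ {n = n} (λ z → c (L z) - c (R z)) (λ z → c (R z)) z
                    | lookup-++ʳ {m = n} (λ z → c (L z) - c (R z)) (λ z → c (R z)) z
                    = a*x+b*[y-x] (c (L z)) (c (R z)) (p (L z)) (p (R z))

  costs-row : ∀ c j → sum (λ w → costs c w * row w j) ≡ c j
  costs-row c = ↑-elim on-L on-R
    where
    open ≡-Reasoning
    costs-L : ∀ z → costs c (L z) ≡ c (L z) - c (R z)
    costs-L = lookup-++ˡ {n = n} (λ z → c (L z) - c (R z)) (λ z → c (R z))
    costs-R : ∀ z → costs c (R z) ≡ c (R z)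
    costs-R = lookup-++ʳ {m = n} (λ z → c (L z) - c (R z)) (λ z → c (R z))
    a-b+b : ∀ a b → a - b + b ≡ a
    a-b+b = solve-∀
    on-L : ∀ z₀ → sum (λ w → costs c w * row w (L z₀)) ≡ c (L z₀)
    on-L z₀ = begin
      sum (λ w → costs c w * row w (L z₀))
        ≡⟨ sum-↑ (λ w → costs c w * row w (L z₀)) ⟩
      sum (λ z → costs c (L z) * row (L z) (L z₀)) + sum (λ z → costs c (R z) * row (R z) (L z₀))
        ≡⟨ cong₂ _+_ (ℤΣ.sum-cong-≗ (λ z → cong (costs c (L z) *_) (row-L-L z z₀)))
                     (ℤΣ.sum-cong-≗ (λ z → cong (costs c (R z) *_) (row-R-L z z₀))) ⟩
      sum (λ z → costs c (L z) * δ (just z₀) z) + sum (λ z → costs c (R z) * δ (just z₀) z)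
        ≡⟨ cong₂ _+_ (sum-*δ (costs c ∘ L) (just z₀)) (sum-*δ (costs c ∘ R) (just z₀)) ⟩
      costs c (L z₀) + costs c (R z₀)
        ≡⟨ cong₂ _+_ (costs-L z₀) (costs-R z₀) ⟩
      c (L z₀) - c (R z₀) + c (R z₀)
        ≡⟨ a-b+b (c (L z₀)) (c (R z₀)) ⟩
      c (L z₀) ∎
    on-R : ∀ z₀ → sum (λ w → costs c w * row w (R z₀)) ≡ c (R z₀)
    on-R z₀ = begin
      sum (λ w → costs c w * row w (R z₀))
        ≡⟨ sum-↑ (λ w → costs c w * row w (R z₀)) ⟩
      sum (λ z → costs c (L z) * row (L z) (R z₀)) + sum (λ z → costs c (R z) * row (R z) (R z₀))
        ≡⟨ cong₂ _+_ (ℤΣ.sum-zero {n} (λ z → trans (cong (costs c (L z) *_) (row-L-R z z₀)) (ℤP.*-zeroʳ (costs c (L z)))))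
                     (ℤΣ.sum-cong-≗ (λ z → cong (costs c (R z) *_) (row-R-R z z₀))) ⟩
      0ℤ + sum (λ z → costs c (R z) * δ (just z₀) z)
        ≡⟨ ℤP.+-identityˡ _ ⟩
      sum (λ z → costs c (R z) * δ (just z₀) z)
        ≡⟨ sum-*δ (costs c ∘ R) (just z₀) ⟩
      costs c (R z₀)
        ≡⟨ costs-R z₀ ⟩
      c (R z₀) ∎

  ArcRow : Row n → Set
  ArcRow ρ = Σ[ arc ∈ Node (n ℕ.+ n) × Node (n ℕ.+ n) ]
               (∀ j → ρ j ≡ at (λ w → row w j) (proj₁ arc) - at (λ w → row w j) (proj₂ arc))

  cover-arc : ∀ x y → ArcRow (_⊖_ {n} (_⊕_ {n} (eℓ x) (eρ x)) (eℓ y))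
  cover-arc x y = (just (R x) , just (L y)) , λ j → sym (cong₂ _-_ (row-R x j) (row-L y j))

  sharp-arc : ∀ x y → ArcRow (_⊖_ {n} (_⊖_ {n} (eℓ x) (eℓ y)) (eρ y))
  sharp-arc x y = (just (L x) , just (R y)) ,
    λ j → trans (a-b-c (eℓ x j) (eℓ y j) (eρ y j)) (sym (cong₂ _-_ (row-L x j) (row-R y j)))
    where
    a-b-c : ∀ a b c → a - b - c ≡ a - (b + c)
    a-b-c = solve-∀

  self-arc : ∀ x → ArcRow (neg {n} (eρ x))
  self-arc x = (just (L x) , just (R x)) ,
    λ j → trans (-c (eℓ x j) (eρ x j)) (sym (cong₂ _-_ (row-L x j) (row-R x j)))
    where
    -c : ∀ a c → - c ≡ a - (a + c)
    -c = solve-∀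

  root-arc : ∀ x → ArcRow (neg {n} (eℓ x))
  root-arc x = (nothing , just (L x)) ,
    λ j → trans (sym (ℤP.+-identityˡ (- eℓ x j))) (cong (λ a → 0ℤ - a) (sym (row-L x j)))

  pairRows-arcs : ∀ ℓ r x y → All ArcRow (pairRows ℓ r x y)
  pairRows-arcs ℓ r x y = ++⁺ (if⁺ (coverZeroᵇ ℓ r x y) (cover-arc x y)) (if⁺ (sharpZeroᵇ ℓ r x y) (sharp-arc x y))

  singleRows-arcs : ∀ ℓ r x → All ArcRow (singleRows ℓ r x)
  singleRows-arcs ℓ r x = ++⁺ (if⁺ (selfZeroᵇ ℓ r x) (self-arc x)) (root-arc x ∷ [])

  MP-rows-arcs : ∀ ℓ r → All ArcRow (MP-rows ℓ r)
  MP-rows-arcs ℓ r = ++⁺ (concatMap⁺ (λ x → concatMap⁺ (pairRows-arcs ℓ r x) (allFin n)) (allFin n))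
                         (concatMap⁺ (singleRows-arcs ℓ r) (allFin n))

  networkForm : ∀ ℓ r → NetworkForm (MP ℓ r)
  networkForm ℓ r = record
    { nodes = n ℕ.+ n
    ; tail = λ i → proj₁ (proj₁ (arc i))
    ; head = λ i → proj₂ (proj₁ (arc i))
    ; row = row
    ; coordinates = coordinates
    ; costs = costs
    ; A≡tension = λ i → proj₂ (arc i)
    ; row-coordinates = row-coordinates
    ; costs-coordinates = costs-coordinates
    ; costs-row = costs-row
    }
    where
    arc : ∀ i → ArcRow (MP ℓ r i)
    arc i = All.lookup (MP-rows-arcs ℓ r) (∈-lookup i)

corollary3p2 : (n : ℕ) (_≺_ : Fin n → Fin n → Set) →
    IsIntervalOrder _≺_ →
    (ℓ r : Fin n → ℕ) (m : ℕ) → IsCanonicalRep _≺_ ℓ r m →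
    (b : Fin (length (MP-rows ℓ r)) → ℤ) → TDI (MP ℓ r) b
corollary3p2 n _≺_ _ ℓ r m _ = networkForm⇒TDI (IntervalOrderMatrix.networkForm n ℓ r)
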